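{- For all sufficiently large $n$, $t_2(n,C^*)=e_2(F_n)$, and $F_n$ is the unique $n$-vertex graph containing no even cycle that attains this maximum.
   Context: All graphs are finite, simple, undirected. For a graph $G$ with degree sequence $d_1,\ldots,d_n$, $e_2(G)=\sum_{i=1}^n d_i^2$. $C^*$ is the family of all even cycles, and $t_2(n,C^*)$ is the maximum of $e_2(G)$ over all $n$-vertex graphs $G$ containing no member of $C^*$ as a subgraph (i.e., no cycle of even length). The friendship graph $F_n$ is obtained from the star with $n$ vertices by adding a maximum matching on its set of $n-1$ leaves. -}

module Defs where

open import Data.Nat using (ℕ; zero; suc; _+_; _*_; _≤_; ⌊_/2⌋)
open import Data.Nat.Base using (_≡ᵇ_)
open import Data.Bool using (Bool; true; false; _∧_; not; if_then_else_)
open import Data.Bool.Properties using (∧-comm)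
open import Data.Fin using (Fin; zero; suc; toℕ; fromℕ; inject₁)
open import Data.List using (List; map; allFin)
open import Data.Nat.ListAction using (sum)
open import Data.Empty using (⊥)
open import Data.Product using (Σ; ∃; _×_; _,_)
open import Relation.Binary.PropositionalEquality using (_≡_; refl; cong; cong₂)
open import Relation.Nullary using (¬_)
open import Function.Definitions using (Injective)
open import Data.Fin.Permutation using (Permutation′; _⟨$⟩ʳ_)

record Graph (n : ℕ) : Set where
  field
    adj    : Fin n → Fin n → Bool
    sym    : ∀ i j → adj i j ≡ adj j i
    irrefl : ∀ i → adj i i ≡ false
open Graph public

deg : ∀ {n} → Graph n → Fin n → ℕ
deg {n} G i = sum (map (λ j → if adj G i j then 1 else 0) (allFin n))

e₂ : ∀ {n} → Graph n → ℕ
e₂ {n} G = sum (map (λ i → deg G i * deg G i) (allFin n))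

HasCycle : ∀ {n} → Graph n → ℕ → Set
HasCycle {n} G zero = ⊥
HasCycle {n} G (suc m) =
  3 ≤ suc m ×
  Σ (Fin (suc m) → Fin n) λ c →
    Injective _≡_ _≡_ c ×
    (∀ (i : Fin m) → adj G (c (inject₁ i)) (c (suc i)) ≡ true) ×
    adj G (c (fromℕ m)) (c zero) ≡ true

EvenCycleFree : ∀ {n} → Graph n → Set
EvenCycleFree G = ∀ (k : ℕ) → ¬ HasCycle G (2 * k)

≡ᵇ-sym : ∀ a b → (a ≡ᵇ b) ≡ (b ≡ᵇ a)
≡ᵇ-sym zero zero = refl
≡ᵇ-sym zero (suc b) = refl
≡ᵇ-sym (suc a) zero = refl
≡ᵇ-sym (suc a) (suc b) = ≡ᵇ-sym a b

≡ᵇ-refl : ∀ a → (a ≡ᵇ a) ≡ true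
≡ᵇ-refl zero = refl
≡ᵇ-refl (suc a) = ≡ᵇ-refl a

-- Friendship adjacency on ℕ: vertex 0 is the centre, adjacent to all others;
-- leaves 1,2,...: leaf (suc a) and leaf (suc b) are matched iff a ≠ b and
-- ⌊a/2⌋ = ⌊b/2⌋, i.e. the matching {1,2},{3,4},{5,6},... (maximum on the leaves).
fadj : ℕ → ℕ → Bool
fadj zero zero = false
fadj zero (suc _) = true
fadj (suc _) zero = true
fadj (suc a) (suc b) = (⌊ a /2⌋ ≡ᵇ ⌊ b /2⌋) ∧ not (a ≡ᵇ b)

fadj-sym : ∀ a b → fadj a b ≡ fadj b a
fadj-sym zero zero = refl
fadj-sym zero (suc b) = refl
fadj-sym (suc a) zero = refl
fadj-sym (suc a) (suc b) = cong₂ _∧_ (≡ᵇ-sym ⌊ a /2⌋ ⌊ b /2⌋) (cong not (≡ᵇ-sym a b))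

fadj-irrefl : ∀ a → fadj a a ≡ false
fadj-irrefl zero = refl
fadj-irrefl (suc a) rewrite ≡ᵇ-refl a | ≡ᵇ-refl ⌊ a /2⌋ = refl

Friendship : (n : ℕ) → Graph n
Friendship n = record
  { adj = λ i j → fadj (toℕ i) (toℕ j)
  ; sym = λ i j → fadj-sym (toℕ i) (toℕ j)
  ; irrefl = λ i → fadj-irrefl (toℕ i)
  }

_≅_ : ∀ {n} → Graph n → Graph n → Set
_≅_ {n} G H = Σ (Permutation′ n) λ σ →
  ∀ i j → adj G i j ≡ adj H (σ ⟨$⟩ʳ i) (σ ⟨$⟩ʳ j)

-- Fix a vertex v of maximum degree Δ and let s = n − Δ count the vertices not adjacent to v, v included.
-- Even-cycle-freeness makes G sparse in two ways: distinct vertices have at most one common neighbour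
-- (there is no 4-cycle), and every induced subgraph on k vertices has at most 2k edges (the start of a
-- maximal path has at most two neighbours in the subgraph, since two chords to later positions close an
-- even cycle). Splitting each degree into its part inside and outside the neighbourhood of v gives
-- e₂(G) ≤ Δ² + 4Δ + s² + 16s, and a small maximum degree gives e₂(G) ≤ 19 · 4n; both lie below e₂(Fₙ)
-- for large n unless s = 1, i.e. v is adjacent to everything. Then every other vertex has at most one
-- neighbour besides v, so G − v is a matching and e₂(G) = m² + m + 6|M| with |M| ≤ ⌊m/2⌋, where m = n − 1.
-- Equality forces |M| = ⌊m/2⌋, and numbering the matching edges by their smaller endpoint gives an
-- isomorphism onto Fₙ.

module Submission where

open import Defs hiding (sym)
open import Data.Nat using (ℕ; _≤_)
open import Data.Product using (∃; _×_)
open import Relation.Binary.PropositionalEquality using (_≡_)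

open import Data.Bool using (Bool; true; false; not; T; if_then_else_)
import Data.Bool as Bool
open import Data.Bool.Properties using (T-≡; T-∧; T-not-≡)
open import Data.Empty using (⊥; ⊥-elim)
open import Data.Fin using (Fin; zero; suc; toℕ; inject₁; fromℕ; fromℕ<; punchOut)
import Data.Fin as Fin
open import Data.Fin.Permutation using (Permutation′; _⟨$⟩ʳ_)
open import Data.Fin.Properties using (toℕ-injective; toℕ-inject₁; toℕ-fromℕ; toℕ-fromℕ<; toℕ<n; any?; injective⇒≤; punchOut-injective)
open import Data.List using (allFin; map; tabulate)
open import Data.List.Properties using (map-tabulate)
open import Data.Nat
open import Data.Nat.Properties
open import Algebra.Properties.Semiring.Sum +-*-semiring using (sum; sum-syntax; ∑-distrib-+; ∑-comm; sum-cong-≗; sum-replicate-zero; *-distribˡ-sum; *-distribʳ-sum)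
import Data.Nat.ListAction as List
open import Data.Nat.Tactic.RingSolver using (solve-∀)
open import Data.Product using (∃-syntax; Σ-syntax; _,_; proj₁; proj₂)
open import Data.Sum using (_⊎_; inj₁; inj₂)
open import Function using (_∘_; id)
open import Function.Bundles using (Equivalence; mk↔ₛ′)
open import Function.Definitions using (Injective)
open import Relation.Binary using (tri<; tri≈; tri>)
open import Relation.Binary.PropositionalEquality
open import Relation.Nullary using (¬_; yes; no; Dec; ofʸ; ofⁿ)
open import Relation.Nullary.Decidable using (_×-dec_; ¬?)


-- Finite sums

private variable n : ℕ

fromBool : Bool → ℕ
fromBool b = if b then 1 else 0

fromBool≤1 : ∀ b → fromBool b ≤ 1
fromBool≤1 true = s≤s z≤n
fromBool≤1 false = z≤n

δ : Fin n → Fin n → ℕ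
δ zero zero = 1
δ zero (suc _) = 0
δ (suc _) zero = 0
δ (suc v) (suc i) = δ v i

δ-refl : (v : Fin n) → δ v v ≡ 1
δ-refl zero = refl
δ-refl (suc v) = δ-refl v

δ-≢ : (v i : Fin n) → i ≢ v → δ v i ≡ 0
δ-≢ zero zero i≢v = ⊥-elim (i≢v refl)
δ-≢ zero (suc i) _ = refl
δ-≢ (suc v) zero _ = refl
δ-≢ (suc v) (suc i) i≢v = δ-≢ v i (i≢v ∘ cong suc)

δ≡1⇒≡ : (v i : Fin n) → δ v i ≡ 1 → i ≡ v
δ≡1⇒≡ zero zero _ = refl
δ≡1⇒≡ (suc v) (suc i) eq = cong suc (δ≡1⇒≡ v i eq)

δ≤1 : (v i : Fin n) → δ v i ≤ 1
δ≤1 zero zero = s≤s z≤n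
δ≤1 zero (suc i) = z≤n
δ≤1 (suc v) zero = z≤n
δ≤1 (suc v) (suc i) = δ≤1 v i

listSum≡∑ : (f : Fin n → ℕ) → List.sum (map f (allFin n)) ≡ sum f
listSum≡∑ {n} f = trans (cong List.sum (map-tabulate id f)) (sum-tabulate n f)
  where
  sum-tabulate : ∀ n (f : Fin n → ℕ) → List.sum (tabulate f) ≡ sum f
  sum-tabulate zero f = refl
  sum-tabulate (suc n) f = cong (f zero +_) (sum-tabulate n (f ∘ suc))

∑-const : ∀ n k → ∑[ i < n ] k ≡ n * k
∑-const zero k = refl
∑-const (suc n) k = cong (k +_) (∑-const n k)

∑-count : ∀ n → ∑[ i < n ] 1 ≡ n
∑-count n = trans (∑-const n 1) (*-identityʳ n)

∑-*ˡ : ∀ k (f : Fin n → ℕ) → ∑[ i < n ] (k * f i) ≡ k * sum f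
∑-*ˡ k f = sym (*-distribˡ-sum k f)

∑-*ʳ : ∀ k (f : Fin n → ℕ) → ∑[ i < n ] (f i * k) ≡ sum f * k
∑-*ʳ k f = sym (*-distribʳ-sum k f)

∑∑≡∑*∑ : (f g : Fin n → ℕ) → ∑[ y < n ] ∑[ z < n ] (f y * g z) ≡ sum f * sum g
∑∑≡∑*∑ f g = trans (sum-cong-≗ (λ y → ∑-*ˡ (f y) g)) (∑-*ʳ (sum g) f)

∑-mono-≤ : {f g : Fin n → ℕ} → (∀ i → f i ≤ g i) → sum f ≤ sum g
∑-mono-≤ {zero} f≤g = z≤n
∑-mono-≤ {suc n} f≤g = +-mono-≤ (f≤g zero) (∑-mono-≤ (f≤g ∘ suc))

∑-δ : (v : Fin n) (f : Fin n → ℕ) → ∑[ i < n ] (δ v i * f i) ≡ f v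
∑-δ {suc n} zero f = trans (cong (f zero + 0 +_) (sum-replicate-zero n)) (trans (+-identityʳ _) (+-identityʳ _))
∑-δ {suc n} (suc v) f = ∑-δ v (f ∘ suc)

∑δ≡1 : (v : Fin n) → sum (δ v) ≡ 1
∑δ≡1 v = trans (sum-cong-≗ {x = δ v} (λ i → sym (*-identityʳ (δ v i)))) (∑-δ v (λ _ → 1))

∑-δ+δ : (x y : Fin n) (f : Fin n → ℕ) → ∑[ i < n ] (δ x i * f i + δ y i * f i) ≡ f x + f y
∑-δ+δ x y f = trans (∑-distrib-+ (λ i → δ x i * f i) (λ i → δ y i * f i)) (cong₂ _+_ (∑-δ x f) (∑-δ y f))

term≤∑ : (f : Fin n → ℕ) (v : Fin n) → f v ≤ sum f
term≤∑ f v = subst (_≤ sum f) (∑-δ v f) (∑-mono-≤ (λ i → bit*≤ (δ v i) (δ≤1 v i)))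
  where
  bit*≤ : ∀ d {x} → d ≤ 1 → d * x ≤ x
  bit*≤ zero _ = z≤n
  bit*≤ (suc zero) {x} _ = ≤-reflexive (+-identityʳ x)
  bit*≤ (suc (suc d)) (s≤s ())

two-terms≤∑ : (f : Fin n → ℕ) (x y : Fin n) → x ≢ y → f x + f y ≤ sum f
two-terms≤∑ f x y x≢y = subst (_≤ sum f) (∑-δ+δ x y f) (∑-mono-≤ δδ*f≤f)
  where
  δδ*f≤f : ∀ i → δ x i * f i + δ y i * f i ≤ f i
  δδ*f≤f i with i Fin.≟ x
  ... | yes refl rewrite δ-refl i | δ-≢ y i x≢y = ≤-reflexive (trans (+-identityʳ _) (+-identityʳ _))
  ... | no i≢x rewrite δ-≢ x i i≢x = ≤-trans (*-monoˡ-≤ (f i) (δ≤1 y i)) (≤-reflexive (+-identityʳ (f i)))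

∑-mono-< : {f g : Fin n → ℕ} (k : Fin n) → (∀ i → f i ≤ g i) → f k < g k → sum f < sum g
∑-mono-< {n} {f} {g} k f≤g fk<gk = subst (_≤ sum g) (+-comm (sum f) 1)
  (≤-trans (≤-reflexive (cong (sum f +_) (sym (∑δ≡1 k)))) (≤-trans (≤-reflexive (sym (∑-distrib-+ f (δ k)))) (∑-mono-≤ f+δ≤g)))
  where
  f+δ≤g : ∀ i → f i + δ k i ≤ g i
  f+δ≤g i with i Fin.≟ k
  ... | yes refl rewrite δ-refl i = subst (_≤ g i) (+-comm 1 (f i)) fk<gk
  ... | no i≢k rewrite δ-≢ k i i≢k = ≤-trans (≤-reflexive (+-identityʳ (f i))) (f≤g i)

∑-unique≤1 : (f : Fin n → ℕ) → (∀ i → f i ≤ 1) → (∀ i j → 1 ≤ f i → 1 ≤ f j → i ≡ j) → sum f ≤ 1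
∑-unique≤1 {n} f f≤1 unique with any? (λ i → 1 ≤? f i)
... | yes (i₀ , 1≤fi₀) = subst (sum f ≤_) (∑δ≡1 i₀) (∑-mono-≤ f≤δ)
  where
  f≤δ : ∀ i → f i ≤ δ i₀ i
  f≤δ i with 1 ≤? f i
  ... | yes 1≤fi rewrite unique i i₀ 1≤fi 1≤fi₀ | δ-refl i₀ = f≤1 i₀
  ... | no 1≰fi = ≤-trans (≤-pred (≰⇒> 1≰fi)) z≤n
... | no none = ≤-trans (≤-trans (∑-mono-≤ f≤0) (≤-reflexive (sum-replicate-zero n))) z≤n
  where
  f≤0 : ∀ i → f i ≤ 0
  f≤0 i = ≤-pred (≰⇒> (λ 1≤fi → none (i , 1≤fi)))

∑≡suc⇒∃≡1 : (S : Fin n → ℕ) → (∀ x → S x ≤ 1) → ∀ {k} → sum S ≡ suc k → ∃[ v ] S v ≡ 1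
∑≡suc⇒∃≡1 {n} S S≤1 ∑S≡1+k with any? (λ y → S y ≟ 1)
... | yes found = found
... | no none = ⊥-elim (1+n≰n (≤-trans (s≤s z≤n) (subst (_≤ 0) ∑S≡1+k (≤-trans (∑-mono-≤ S≤0) (≤-reflexive (sum-replicate-zero n))))))
  where
  S≤0 : ∀ y → S y ≤ 0
  S≤0 y with S y in eq | S≤1 y
  ... | zero | _ = z≤n
  ... | suc zero | _ = ⊥-elim (none (y , eq))
  ... | suc (suc _) | s≤s ()

∑∑-symmetric-even : (g : Fin n → Fin n → ℕ) → (∀ i j → g i j ≡ g j i) → (∀ i → g i i ≡ 0) →
  ∃[ k ] ∑[ i < n ] ∑[ j < n ] g i j ≡ k + k
∑∑-symmetric-even {zero} g _ _ = 0 , refl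
∑∑-symmetric-even {suc n} g g-sym g-diag
  with ∑∑-symmetric-even (λ i j → g (suc i) (suc j)) (λ i j → g-sym (suc i) (suc j)) (g-diag ∘ suc)
... | k , ∑∑≡k+k = r + k , (begin
  (g zero zero + r) + ∑[ i < n ] (g (suc i) zero + ∑[ j < n ] g (suc i) (suc j))
    ≡⟨ cong₂ _+_ (cong (_+ r) (g-diag zero)) (∑-distrib-+ (λ i → g (suc i) zero) (λ i → ∑[ j < n ] g (suc i) (suc j))) ⟩
  r + (∑[ i < n ] g (suc i) zero + ∑[ i < n ] ∑[ j < n ] g (suc i) (suc j))
    ≡⟨ cong₂ (λ a b → r + (a + b)) (sum-cong-≗ (λ i → g-sym (suc i) zero)) ∑∑≡k+k ⟩
  r + (r + (k + k))
    ≡⟨ regroup r k ⟩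
  (r + k) + (r + k) ∎)
  where
  open ≡-Reasoning
  r : ℕ
  r = ∑[ j < n ] g zero (suc j)
  regroup : ∀ r k → r + (r + (k + k)) ≡ (r + k) + (r + k)
  regroup = solve-∀

∑-initialSegment : ∀ n k → k ≤ n → ∑[ i < n ] (if toℕ i <ᵇ k then 1 else 0) ≡ k
∑-initialSegment n zero _ = sum-replicate-zero n
∑-initialSegment (suc n) (suc k) (s≤s k≤n) = cong suc (∑-initialSegment n k k≤n)

-- Degrees, codegrees and 4-cycles

bit*bit≤1 : ∀ {a b} → a ≤ 1 → b ≤ 1 → a * b ≤ 1
bit*bit≤1 {zero} _ _ = z≤n
bit*bit≤1 {suc zero} {b} _ b≤1 = subst (_≤ 1) (sym (+-identityʳ b)) b≤1
bit*bit≤1 {suc (suc _)} (s≤s ()) _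

1≤m*n⇒1≤m×1≤n : ∀ a b → 1 ≤ a * b → 1 ≤ a × 1 ≤ b
1≤m*n⇒1≤m×1≤n (suc a) (suc b) _ = s≤s z≤n , s≤s z≤n
1≤m*n⇒1≤m×1≤n (suc a) zero 1≤a*0 = ⊥-elim (1+n≰n (subst (1 ≤_) (*-zeroʳ a) 1≤a*0))

bit*bit≡bit : ∀ {b} → b ≤ 1 → b * b ≡ b
bit*bit≡bit z≤n = refl
bit*bit≡bit (s≤s z≤n) = refl

module _ {n : ℕ} (G : Graph n) where

  A : Fin n → Fin n → ℕ
  A x y = fromBool (adj G x y)

  A-sym : ∀ x y → A x y ≡ A y x
  A-sym x y = cong fromBool (Graph.sym G x y)

  A-irrefl : ∀ x → A x x ≡ 0
  A-irrefl x = cong fromBool (irrefl G x)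

  A≤1 : ∀ x y → A x y ≤ 1
  A≤1 x y = fromBool≤1 (adj G x y)

  adj-sym : ∀ {x y} → adj G x y ≡ true → adj G y x ≡ true
  adj-sym {x} {y} xy = trans (Graph.sym G y x) xy

  1≤A⇒adj : ∀ {x y} → 1 ≤ A x y → adj G x y ≡ true
  1≤A⇒adj {x} {y} 1≤A with adj G x y
  ... | true = refl

  1≤A⇒≢ : ∀ {x y} → 1 ≤ A x y → x ≢ y
  1≤A⇒≢ {x} 1≤A refl = 1+n≰n (subst (1 ≤_) (A-irrefl x) 1≤A)

  degree : Fin n → ℕ
  degree x = sum (A x)

  e₂≡∑degree² : e₂ G ≡ ∑[ x < n ] (degree x * degree x)
  e₂≡∑degree² = trans (listSum≡∑ (λ x → deg G x * deg G x))
    (sum-cong-≗ (λ x → cong₂ _*_ (listSum≡∑ (A x)) (listSum≡∑ (A x))))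

  codegree : Fin n → Fin n → ℕ
  codegree y z = ∑[ x < n ] (A y x * A x z)

  codegree-self : ∀ y → codegree y y ≡ degree y
  codegree-self y = sum-cong-≗ (λ x → trans (cong (A y x *_) (A-sym x y)) (bit*bit≡bit (A≤1 y x)))

  4-cycle : ∀ {a b c d} → a ≢ b → a ≢ c → a ≢ d → b ≢ c → b ≢ d → c ≢ d →
    adj G a b ≡ true → adj G b c ≡ true → adj G c d ≡ true → adj G d a ≡ true → HasCycle G 4
  4-cycle {a} {b} {c} {d} a≢b a≢c a≢d b≢c b≢d c≢d ab bc cd da = s≤s (s≤s (s≤s z≤n)) , cyc , inj , path , da
    where
    cyc : Fin 4 → Fin n
    cyc zero = a
    cyc (suc zero) = b
    cyc (suc (suc zero)) = c
    cyc (suc (suc (suc zero))) = d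
    inj : Injective _≡_ _≡_ cyc
    inj {zero} {zero} _ = refl
    inj {zero} {suc zero} e = ⊥-elim (a≢b e)
    inj {zero} {suc (suc zero)} e = ⊥-elim (a≢c e)
    inj {zero} {suc (suc (suc zero))} e = ⊥-elim (a≢d e)
    inj {suc zero} {zero} e = ⊥-elim (a≢b (sym e))
    inj {suc zero} {suc zero} _ = refl
    inj {suc zero} {suc (suc zero)} e = ⊥-elim (b≢c e)
    inj {suc zero} {suc (suc (suc zero))} e = ⊥-elim (b≢d e)
    inj {suc (suc zero)} {zero} e = ⊥-elim (a≢c (sym e))
    inj {suc (suc zero)} {suc zero} e = ⊥-elim (b≢c (sym e))
    inj {suc (suc zero)} {suc (suc zero)} _ = refl
    inj {suc (suc zero)} {suc (suc (suc zero))} e = ⊥-elim (c≢d e)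
    inj {suc (suc (suc zero))} {zero} e = ⊥-elim (a≢d (sym e))
    inj {suc (suc (suc zero))} {suc zero} e = ⊥-elim (b≢d (sym e))
    inj {suc (suc (suc zero))} {suc (suc zero)} e = ⊥-elim (c≢d (sym e))
    inj {suc (suc (suc zero))} {suc (suc (suc zero))} _ = refl
    path : ∀ (i : Fin 3) → adj G (cyc (inject₁ i)) (cyc (suc i)) ≡ true
    path zero = ab
    path (suc zero) = bc
    path (suc (suc zero)) = cd

  -- two common neighbours of distinct y and z would span a 4-cycle
  codegree≤1 : EvenCycleFree G → ∀ {y z} → y ≢ z → codegree y z ≤ 1
  codegree≤1 noEven {y} {z} y≢z = ∑-unique≤1 (λ x → A y x * A x z)
    (λ x → bit*bit≤1 (A≤1 y x) (A≤1 x z)) unique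
    where
    unique : ∀ x x′ → 1 ≤ A y x * A x z → 1 ≤ A y x′ * A x′ z → x ≡ x′
    unique x x′ yxz yx′z with x Fin.≟ x′ | 1≤m*n⇒1≤m×1≤n (A y x) (A x z) yxz | 1≤m*n⇒1≤m×1≤n (A y x′) (A x′ z) yx′z
    ... | yes x≡x′ | _ | _ = x≡x′
    ... | no x≢x′ | yx , xz | yx′ , x′z = ⊥-elim (noEven 2 (4-cycle
      (1≤A⇒≢ yx) y≢z (1≤A⇒≢ yx′) (1≤A⇒≢ xz) x≢x′ (1≤A⇒≢ x′z ∘ sym)
      (1≤A⇒adj yx) (1≤A⇒adj xz) (adj-sym (1≤A⇒adj x′z)) (adj-sym (1≤A⇒adj yx′))))

-- Maximal paths and sparse induced subgraphs

≤⇒∃+ : ∀ {a b} → a ≤ b → ∃[ c ] a + c ≡ b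
≤⇒∃+ {zero} {b} _ = b , refl
≤⇒∃+ (s≤s a≤b) with ≤⇒∃+ a≤b
... | c , refl = c , refl

true≢false : true ≢ false
true≢false ()

even : ℕ → Bool
even zero = true
even (suc zero) = false
even (suc (suc m)) = even m

even-suc : ∀ m → even (suc m) ≡ not (even m)
even-suc zero = refl
even-suc (suc zero) = refl
even-suc (suc (suc m)) = even-suc m

even-+ : ∀ m k → even m ≡ true → even (m + k) ≡ even k
even-+ zero k _ = refl
even-+ (suc (suc m)) k e = even-+ m k e

even⇒double : ∀ m → even m ≡ true → ∃[ k ] m ≡ 2 * k
even⇒double zero _ = 0 , refl
even⇒double (suc (suc m)) e with even⇒double m e
... | k , refl = suc k , cong suc (sym (+-suc k (k + 0)))

module _ {n : ℕ} (G : Graph n) (S : Fin n → ℕ) where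

  record Path : Set where
    field
      length : ℕ
      vertex : ℕ → Fin n
      vertex∈S : ∀ i → i < length → S (vertex i) ≡ 1
      step : ∀ i → suc i < length → adj G (vertex i) (vertex (suc i)) ≡ true
      vertex-injective : ∀ i j → i < length → j < length → vertex i ≡ vertex j → i ≡ j

    start : Fin n
    start = vertex 0
  open Path

  chordCycle : (p : Path) → ∀ a d → 1 ≤ a → a + suc d < length p →
    adj G (start p) (vertex p a) ≡ true → adj G (start p) (vertex p (a + suc d)) ≡ true →
    HasCycle G (3 + d)
  chordCycle p a d 1≤a a+1+d<len chord₁ chord₂ = s≤s (s≤s (s≤s z≤n)) , cyc , inj , edges , closing
    where
    cyc : Fin (3 + d) → Fin n
    cyc zero = start p
    cyc (suc t) = vertex p (a + toℕ t)
    bound : ∀ (t : Fin (2 + d)) → a + toℕ t < length p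
    bound t = ≤-trans (s≤s (+-monoʳ-≤ a (s≤s⁻¹ (toℕ<n t)))) a+1+d<len
    0<len : 0 < length p
    0<len = ≤-trans (s≤s z≤n) a+1+d<len
    start≢ : ∀ t → start p ≢ vertex p (a + toℕ t)
    start≢ t eq = 1+n≰n (≤-trans 1≤a (≤-trans (m≤m+n a (toℕ t))
      (≤-reflexive (sym (vertex-injective p 0 (a + toℕ t) 0<len (bound t) eq)))))
    inj : Injective _≡_ _≡_ cyc
    inj {zero} {zero} _ = refl
    inj {zero} {suc t} eq = ⊥-elim (start≢ t eq)
    inj {suc t} {zero} eq = ⊥-elim (start≢ t (sym eq))
    inj {suc t} {suc t′} eq =
      cong suc (toℕ-injective (+-cancelˡ-≡ a _ _ (vertex-injective p _ _ (bound t) (bound t′) eq)))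
    edges : ∀ (i : Fin (2 + d)) → adj G (cyc (inject₁ i)) (cyc (suc i)) ≡ true
    edges zero = subst (λ j → adj G (start p) (vertex p j) ≡ true) (sym (+-identityʳ a)) chord₁
    edges (suc t) = subst₂ (λ i j → adj G (vertex p i) (vertex p j) ≡ true)
      (cong (a +_) (sym (toℕ-inject₁ t))) (sym (+-suc a (toℕ t)))
      (step p (a + toℕ t) (subst (_< length p) (+-suc a (toℕ t)) (bound (suc t))))
    closing : adj G (cyc (fromℕ (2 + d))) (cyc zero) ≡ true
    closing = subst (λ j → adj G (vertex p (a + j)) (start p) ≡ true) (sym (toℕ-fromℕ (suc d)))
      (adj-sym G chord₂)

  chord-odd : EvenCycleFree G → (p : Path) → ∀ a d → 1 ≤ a → a + suc d < length p →
    adj G (start p) (vertex p a) ≡ true → adj G (start p) (vertex p (a + suc d)) ≡ true →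
    even (suc d) ≡ false
  chord-odd noEven p a d 1≤a a+1+d<len chord₁ chord₂ with even (suc d) in e
  ... | false = refl
  ... | true with even⇒double (3 + d) e
  ... | k , 3+d≡2k = ⊥-elim (noEven k (subst (HasCycle G) 3+d≡2k (chordCycle p a d 1≤a a+1+d<len chord₁ chord₂)))

  cons : (y : Fin n) (p : Path) → S y ≡ 1 → 1 ≤ length p → adj G y (start p) ≡ true →
    (∀ i → i < length p → vertex p i ≢ y) → Path
  cons y p y∈S 1≤len y~start new = record
    { length = suc (length p) ; vertex = vertex′ ; vertex∈S = vertex∈S′ ; step = step′ ; vertex-injective = injective′ }
    where
    vertex′ : ℕ → Fin n
    vertex′ zero = y
    vertex′ (suc i) = vertex p i
    vertex∈S′ : ∀ i → i < suc (length p) → S (vertex′ i) ≡ 1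
    vertex∈S′ zero _ = y∈S
    vertex∈S′ (suc i) (s≤s i<len) = vertex∈S p i i<len
    step′ : ∀ i → suc i < suc (length p) → adj G (vertex′ i) (vertex′ (suc i)) ≡ true
    step′ zero _ = y~start
    step′ (suc i) (s≤s i<len) = step p i i<len
    injective′ : ∀ i j → i < suc (length p) → j < suc (length p) → vertex′ i ≡ vertex′ j → i ≡ j
    injective′ zero zero _ _ _ = refl
    injective′ zero (suc j) _ (s≤s j<len) eq = ⊥-elim (new j j<len (sym eq))
    injective′ (suc i) zero (s≤s i<len) _ eq = ⊥-elim (new i i<len eq)
    injective′ (suc i) (suc j) (s≤s i<len) (s≤s j<len) eq = cong suc (vertex-injective p i j i<len j<len eq)

  singleton : (v : Fin n) → S v ≡ 1 → Path
  singleton v v∈S = record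
    { length = 1 ; vertex = λ _ → v ; vertex∈S = λ _ _ → v∈S ; step = λ { i (s≤s ()) }
    ; vertex-injective = λ { zero zero _ _ _ → refl ; (suc i) _ (s≤s ()) _ _ ; zero (suc j) _ (s≤s ()) _ } }

  Maximal : Path → Set
  Maximal p = ∀ y → S y ≡ 1 → adj G (start p) y ≡ true → ∃[ i ] i < length p × vertex p i ≡ y

  length≤n : (p : Path) → length p ≤ n
  length≤n p = injective⇒≤ {f = λ (i : Fin (length p)) → vertex p (toℕ i)}
    (λ {i} {j} eq → toℕ-injective (vertex-injective p (toℕ i) (toℕ j) (toℕ<n i) (toℕ<n j) eq))

  -- k is fuel: no path has more than n vertices
  extendToMaximal : ∀ k (p : Path) → 1 ≤ length p → n < length p + k → Σ[ p′ ∈ Path ] 1 ≤ length p′ × Maximal p′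
  extendToMaximal zero p _ n<len = ⊥-elim (<⇒≱ n<len (subst (_≤ n) (sym (+-identityʳ (length p))) (length≤n p)))
  extendToMaximal (suc k) p 1≤len n<len+k
    with any? (λ y → (S y ≟ 1) ×-dec (adj G y (start p) Bool.≟ true) ×-dec ¬? (onPath? y))
    where
    onPath? : (y : Fin n) → Dec (∃ λ (i : Fin (length p)) → vertex p (toℕ i) ≡ y)
    onPath? y = any? (λ i → vertex p (toℕ i) Fin.≟ y)
  ... | yes (y , y∈S , y~start , off) =
    extendToMaximal k (cons y p y∈S 1≤len y~start new) (s≤s z≤n) (subst (n <_) (+-suc (length p) k) n<len+k)
    where
    new : ∀ i → i < length p → vertex p i ≢ y
    new i i<len eq = off (fromℕ< i<len , trans (cong (vertex p) (toℕ-fromℕ< i<len)) eq)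
  ... | no none = p , 1≤len , maximal
    where
    maximal : Maximal p
    maximal y y∈S start~y with any? (λ (i : Fin (length p)) → vertex p (toℕ i) Fin.≟ y)
    ... | yes (i , eq) = toℕ i , toℕ<n i , eq
    ... | no off = ⊥-elim (none (y , y∈S , adj-sym G start~y , off))

  degreeIn : Fin n → ℕ
  degreeIn x = ∑[ y < n ] (S y * A G x y)

  degreeSumIn : ℕ
  degreeSumIn = ∑[ x < n ] (S x * degreeIn x)

  -- The start of a maximal path has all its S-neighbours on the path. Besides the second vertex at most one
  -- of them exists: chords to positions 2 ≤ i < j are both even, so start, vertex i, …, vertex j is an even cycle.
  module MaximalPathStart (noEven : EvenCycleFree G) (S≤1 : ∀ x → S x ≤ 1) (p : Path) (maximal : Maximal p) where
    h : Fin n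
    h = start p

    chord-even : ∀ i → 2 ≤ i → i < length p → adj G h (vertex p i) ≡ true → even i ≡ true
    chord-even (suc zero) (s≤s ()) _ _
    chord-even (suc (suc j)) _ i<len chord with even j in e
    ... | true = refl
    ... | false = ⊥-elim (true≢false (trans (sym (trans (even-suc j) (cong not e)))
      (chord-odd noEven p 1 j (s≤s z≤n) i<len (step p 0 (≤-trans (s≤s (s≤s z≤n)) i<len)) chord)))

    two-far-chords : ∀ i j → 2 ≤ i → i < j → j < length p →
      adj G h (vertex p i) ≡ true → adj G h (vertex p j) ≡ true → ⊥
    two-far-chords i j 2≤i i<j j<len chordᵢ chordⱼ with ≤⇒∃+ i<j
    ... | d , refl = true≢false (trans (sym (chord-even (suc i + d) (≤-trans 2≤i (≤-trans (n≤1+n i) (m≤m+n (suc i) d))) j<len chordⱼ))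
        (trans (trans (cong even (sym (+-suc i d))) (even-+ i (suc d) (chord-even i 2≤i (<-trans i<j j<len) chordᵢ)))
          (chord-odd noEven p i d (≤-trans (s≤s z≤n) 2≤i) (subst (_< length p) (sym (+-suc i d)) j<len)
            chordᵢ (subst (λ j → adj G h (vertex p j) ≡ true) (sym (+-suc i d)) chordⱼ))))

    FarNeighbour : Fin n → Set
    FarNeighbour w = ∀ i → 2 ≤ i → i < length p → adj G h (vertex p i) ≡ true → vertex p i ≡ w

    farNeighbour : ∃ FarNeighbour
    farNeighbour with any? (λ (j : Fin (length p)) → (2 ≤? toℕ j) ×-dec (adj G h (vertex p (toℕ j)) Bool.≟ true))
    ... | yes (j , 2≤j , chordⱼ) = vertex p (toℕ j) , far
      where
      far : FarNeighbour (vertex p (toℕ j))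
      far i 2≤i i<len chordᵢ with <-cmp i (toℕ j)
      ... | tri< i<j _ _ = ⊥-elim (two-far-chords i (toℕ j) 2≤i i<j (toℕ<n j) chordᵢ chordⱼ)
      ... | tri≈ _ i≡j _ = cong (vertex p) i≡j
      ... | tri> _ _ j<i = ⊥-elim (two-far-chords (toℕ j) i 2≤j j<i i<len chordⱼ chordᵢ)
    ... | no none = h , λ i 2≤i i<len chordᵢ → ⊥-elim (none (fromℕ< i<len ,
      subst (2 ≤_) (sym (toℕ-fromℕ< i<len)) 2≤i ,
      subst (λ j → adj G h (vertex p j) ≡ true) (sym (toℕ-fromℕ< i<len)) chordᵢ))

    neighbour≤δ+δ : ∀ w → FarNeighbour w → ∀ y → S y * A G h y ≤ δ (vertex p 1) y + δ w y
    neighbour≤δ+δ w far y with adj G h y in h~y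
    ... | false = subst (_≤ δ (vertex p 1) y + δ w y) (sym (*-zeroʳ (S y))) z≤n
    ... | true with S y in y∈S | S≤1 y
    ... | zero | _ = z≤n
    ... | suc (suc _) | s≤s ()
    ... | suc zero | _ with maximal y y∈S h~y
    ... | zero , _ , refl = ⊥-elim (true≢false (trans (sym h~y) (irrefl G h)))
    ... | suc zero , _ , refl = ≤-trans (≤-reflexive (sym (δ-refl (vertex p 1)))) (m≤m+n _ _)
    ... | suc (suc j) , j<len , refl =
      ≤-trans (≤-reflexive (sym (trans (cong (δ w) (far (2 + j) (s≤s (s≤s z≤n)) j<len h~y)) (δ-refl w)))) (m≤n+m _ _)

    degreeIn-start≤2 : degreeIn h ≤ 2
    degreeIn-start≤2 with farNeighbour
    ... | w , far = ≤-trans (∑-mono-≤ (neighbour≤δ+δ w far))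
      (≤-reflexive (trans (∑-distrib-+ (δ (vertex p 1)) (δ w)) (cong₂ _+_ (∑δ≡1 (vertex p 1)) (∑δ≡1 w))))

  lowDegreeVertex : EvenCycleFree G → (∀ x → S x ≤ 1) → ∀ v → S v ≡ 1 → ∃[ h ] S h ≡ 1 × degreeIn h ≤ 2
  lowDegreeVertex noEven S≤1 v v∈S with extendToMaximal n (singleton v v∈S) (s≤s z≤n) (n<1+n n)
  ... | p , 1≤len , maximal = start p , vertex∈S p 0 1≤len , MaximalPathStart.degreeIn-start≤2 noEven S≤1 p maximal

module _ {n : ℕ} (G : Graph n) where

  module Remove (S : Fin n → ℕ) (h : Fin n) (h∈S : S h ≡ 1) where
    S′ : Fin n → ℕ
    S′ x = S x ∸ δ h x

    S≡S′+δ : ∀ x → S x ≡ S′ x + δ h x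
    S≡S′+δ x with x Fin.≟ h
    ... | yes refl rewrite h∈S | δ-refl h = refl
    ... | no x≢h rewrite δ-≢ h x x≢h = sym (+-identityʳ (S x))

    S′≤S : ∀ x → S′ x ≤ S x
    S′≤S x = m∸n≤m (S x) (δ h x)

    ∑S≡∑S′+1 : sum S ≡ sum S′ + 1
    ∑S≡∑S′+1 = trans (sum-cong-≗ S≡S′+δ) (trans (∑-distrib-+ S′ (δ h)) (cong (sum S′ +_) (∑δ≡1 h)))

    degreeIn-remove : ∀ x → degreeIn G S x ≡ degreeIn G S′ x + A G x h
    degreeIn-remove x = begin
      ∑[ y < n ] (S y * A G x y)                        ≡⟨ sum-cong-≗ (λ y → trans (cong (_* A G x y) (S≡S′+δ y)) (*-distribʳ-+ (A G x y) (S′ y) (δ h y))) ⟩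
      ∑[ y < n ] (S′ y * A G x y + δ h y * A G x y)     ≡⟨ ∑-distrib-+ (λ y → S′ y * A G x y) (λ y → δ h y * A G x y) ⟩
      degreeIn G S′ x + ∑[ y < n ] (δ h y * A G x y)    ≡⟨ cong (degreeIn G S′ x +_) (∑-δ h (A G x)) ⟩
      degreeIn G S′ x + A G x h                         ∎
      where open ≡-Reasoning

    -- removing h loses its own term and one unit of degree at each of its S-neighbours
    degreeSumIn-remove : degreeSumIn G S ≤ degreeSumIn G S′ + degreeIn G S h + degreeIn G S h
    degreeSumIn-remove = begin
      ∑[ x < n ] (S x * D x)                                ≡⟨ sum-cong-≗ (λ x → trans (cong (_* D x) (S≡S′+δ x)) (*-distribʳ-+ (D x) (S′ x) (δ h x))) ⟩
      ∑[ x < n ] (S′ x * D x + δ h x * D x)                 ≡⟨ ∑-distrib-+ (λ x → S′ x * D x) (λ x → δ h x * D x) ⟩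
      ∑[ x < n ] (S′ x * D x) + ∑[ x < n ] (δ h x * D x)   ≡⟨ cong (∑[ x < n ] (S′ x * D x) +_) (∑-δ h D) ⟩
      ∑[ x < n ] (S′ x * D x) + D h                         ≡⟨ cong (_+ D h) (sum-cong-≗ (λ x → trans (cong (S′ x *_) (degreeIn-remove x)) (*-distribˡ-+ (S′ x) _ (A G x h)))) ⟩
      ∑[ x < n ] (S′ x * degreeIn G S′ x + S′ x * A G x h) + D h
        ≡⟨ cong (_+ D h) (∑-distrib-+ (λ x → S′ x * degreeIn G S′ x) (λ x → S′ x * A G x h)) ⟩
      degreeSumIn G S′ + ∑[ x < n ] (S′ x * A G x h) + D h
        ≤⟨ +-monoˡ-≤ (D h) (+-monoʳ-≤ (degreeSumIn G S′) (∑-mono-≤ (λ x → *-mono-≤ (S′≤S x) (≤-reflexive (A-sym G x h))))) ⟩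
      degreeSumIn G S′ + D h + D h                            ∎
      where
      open ≤-Reasoning
      D : Fin n → ℕ
      D = degreeIn G S

  -- peel off a vertex with at most two neighbours in S, which costs at most 4
  degreeSumIn≤4*size : EvenCycleFree G → ∀ k (S : Fin n → ℕ) → (∀ x → S x ≤ 1) → sum S ≡ k → degreeSumIn G S ≤ 4 * k
  degreeSumIn≤4*size _ zero S S≤1 ∑S≡0 = ≤-trans (∑-mono-≤ (λ x → ≤-reflexive (cong (_* degreeIn G S x) (S≡0 x)))) (≤-reflexive (sum-replicate-zero n))
    where
    S≡0 : ∀ x → S x ≡ 0
    S≡0 x = n≤0⇒n≡0 (subst (S x ≤_) ∑S≡0 (term≤∑ S x))
  degreeSumIn≤4*size noEven (suc k) S S≤1 ∑S≡1+k with ∑≡suc⇒∃≡1 S S≤1 ∑S≡1+k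
  ... | v , v∈S with lowDegreeVertex G S noEven S≤1 v v∈S
  ... | h , h∈S , degh≤2 = begin
    degreeSumIn G S                                   ≤⟨ degreeSumIn-remove ⟩
    degreeSumIn G S′ + degreeIn G S h + degreeIn G S h ≤⟨ +-mono-≤ (+-mono-≤ ih degh≤2) degh≤2 ⟩
    4 * k + 2 + 2                                   ≡⟨ trans (+-assoc (4 * k) 2 2) (trans (+-comm (4 * k) 4) (sym (*-suc 4 k))) ⟩
    4 * suc k                                        ∎
    where
    open Remove S h h∈S
    open ≤-Reasoning
    ih : degreeSumIn G S′ ≤ 4 * k
    ih = degreeSumIn≤4*size noEven k S′ (λ x → ≤-trans (S′≤S x) (S≤1 x))
      (+-cancelʳ-≡ 1 (sum S′) k (trans (sym ∑S≡∑S′+1) (trans ∑S≡1+k (+-comm 1 k))))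

-- Degrees around a fixed vertex

module Neighbourhood {n : ℕ} (G : Graph n) (noEven : EvenCycleFree G) (v : Fin n) where

  Δ : ℕ
  Δ = degree G v

  far : Fin n → ℕ
  far x = 1 ∸ A G v x

  s : ℕ
  s = sum far

  outDegree : Fin n → ℕ
  outDegree = degreeIn G far

  A+far≡1 : ∀ x → A G v x + far x ≡ 1
  A+far≡1 x = m+[n∸m]≡n (A≤1 G v x)

  far≤1 : ∀ x → far x ≤ 1
  far≤1 x = m∸n≤m 1 (A G v x)

  far-v : far v ≡ 1
  far-v = cong (1 ∸_) (A-irrefl G v)

  n≡Δ+s : n ≡ Δ + s
  n≡Δ+s = trans (sym (∑-count n)) (trans (sum-cong-≗ (sym ∘ A+far≡1)) (∑-distrib-+ (A G v) far))

  codegree-v≤1 : ∀ {x} → x ≢ v → codegree G v x ≤ 1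
  codegree-v≤1 x≢v = codegree≤1 G noEven (x≢v ∘ sym)

  degree≡codegree+outDegree : ∀ x → degree G x ≡ codegree G v x + outDegree x
  degree≡codegree+outDegree x = begin
    ∑[ y < n ] A G x y                                   ≡⟨ sum-cong-≗ split ⟩
    ∑[ y < n ] (A G v y * A G y x + far y * A G x y)     ≡⟨ ∑-distrib-+ (λ y → A G v y * A G y x) (λ y → far y * A G x y) ⟩
    codegree G v x + outDegree x                          ∎
    where
    open ≡-Reasoning
    split : ∀ y → A G x y ≡ A G v y * A G y x + far y * A G x y
    split y = begin
      A G x y                            ≡⟨ trans (cong (_* A G x y) (A+far≡1 y)) (*-identityˡ (A G x y)) ⟨
      (A G v y + far y) * A G x y        ≡⟨ *-distribʳ-+ (A G x y) (A G v y) (far y) ⟩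
      A G v y * A G x y + far y * A G x y ≡⟨ cong (λ t → A G v y * t + far y * A G x y) (A-sym G x y) ⟩
      A G v y * A G y x + far y * A G x y ∎

  degree≤1+outDegree : ∀ {x} → x ≢ v → degree G x ≤ 1 + outDegree x
  degree≤1+outDegree {x} x≢v = subst (_≤ 1 + outDegree x) (sym (degree≡codegree+outDegree x))
    (+-monoˡ-≤ (outDegree x) (codegree-v≤1 x≢v))

  e₂≤Δ²+n+2∑out+∑out² : e₂ G ≤ Δ * Δ + n + 2 * sum outDegree + ∑[ x < n ] (outDegree x * outDegree x)
  e₂≤Δ²+n+2∑out+∑out² = begin
    e₂ G                                                         ≡⟨ e₂≡∑degree² G ⟩
    ∑[ x < n ] (degree G x * degree G x)                        ≤⟨ ∑-mono-≤ bound ⟩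
    ∑[ x < n ] (δ v x * (Δ * Δ) + (1 + 2 * outDegree x + outDegree x * outDegree x))
      ≡⟨ ∑-distrib-+ (λ x → δ v x * (Δ * Δ)) (λ x → 1 + 2 * outDegree x + outDegree x * outDegree x) ⟩
    ∑[ x < n ] (δ v x * (Δ * Δ)) + ∑[ x < n ] (1 + 2 * outDegree x + outDegree x * outDegree x)
      ≡⟨ cong₂ _+_ (∑-δ v (λ _ → Δ * Δ)) (trans (∑-distrib-+ (λ x → 1 + 2 * outDegree x) _)
           (cong (_+ ∑[ x < n ] (outDegree x * outDegree x)) (trans (∑-distrib-+ (λ _ → 1) (λ x → 2 * outDegree x)) (cong₂ _+_ (∑-count n) (∑-*ˡ 2 outDegree))))) ⟩
    Δ * Δ + (n + 2 * sum outDegree + ∑[ x < n ] (outDegree x * outDegree x))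
      ≡⟨ sym (+-assoc (Δ * Δ) _ _) ⟩
    Δ * Δ + (n + 2 * sum outDegree) + ∑[ x < n ] (outDegree x * outDegree x)
      ≡⟨ cong (_+ ∑[ x < n ] (outDegree x * outDegree x)) (sym (+-assoc (Δ * Δ) n _)) ⟩
    Δ * Δ + n + 2 * sum outDegree + ∑[ x < n ] (outDegree x * outDegree x) ∎
    where
    open ≤-Reasoning
    square-suc : ∀ w → (1 + w) * (1 + w) ≡ 1 + 2 * w + w * w
    square-suc = solve-∀
    bound : ∀ x → degree G x * degree G x ≤ δ v x * (Δ * Δ) + (1 + 2 * outDegree x + outDegree x * outDegree x)
    bound x with x Fin.≟ v
    ... | yes refl rewrite δ-refl v = ≤-trans (≤-reflexive (sym (+-identityʳ (Δ * Δ)))) (m≤m+n _ _)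
    ... | no x≢v rewrite δ-≢ v x x≢v = ≤-trans (*-mono-≤ (degree≤1+outDegree x≢v) (degree≤1+outDegree x≢v))
      (≤-reflexive (square-suc (outDegree x)))

  ∑outDegree≡∑degree*far : sum outDegree ≡ ∑[ y < n ] (degree G y * far y)
  ∑outDegree≡∑degree*far = begin
    ∑[ x < n ] ∑[ y < n ] (far y * A G x y)   ≡⟨ ∑-comm (λ x y → far y * A G x y) ⟩
    ∑[ y < n ] ∑[ x < n ] (far y * A G x y)   ≡⟨ sum-cong-≗ (λ y → ∑-*ˡ (far y) (λ x → A G x y)) ⟩
    ∑[ y < n ] (far y * ∑[ x < n ] A G x y)   ≡⟨ sum-cong-≗ (λ y → trans (*-comm (far y) _) (cong (_* far y) (sum-cong-≗ (λ x → A-sym G x y)))) ⟩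
    ∑[ y < n ] (degree G y * far y)           ∎
    where open ≡-Reasoning

  -- ∑ₓ outDegree x ² counts pairs of far vertices y, z with a common neighbour x; by C4-freeness
  -- each pair with y ≢ z has at most one
  ∑outDegree²≤ : ∑[ x < n ] (outDegree x * outDegree x) ≤ ∑[ y < n ] (degree G y * far y) + s * s
  ∑outDegree²≤ = begin
    ∑[ x < n ] (outDegree x * outDegree x)
      ≡⟨ sum-cong-≗ (λ x → sym (∑∑≡∑*∑ (λ y → far y * A G x y) (λ z → far z * A G x z))) ⟩
    ∑[ x < n ] ∑[ y < n ] ∑[ z < n ] ((far y * A G x y) * (far z * A G x z))
      ≡⟨ ∑-comm (λ x y → ∑[ z < n ] ((far y * A G x y) * (far z * A G x z))) ⟩
    ∑[ y < n ] ∑[ x < n ] ∑[ z < n ] ((far y * A G x y) * (far z * A G x z))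
      ≡⟨ sum-cong-≗ (λ y → ∑-comm (λ x z → (far y * A G x y) * (far z * A G x z))) ⟩
    ∑[ y < n ] ∑[ z < n ] ∑[ x < n ] ((far y * A G x y) * (far z * A G x z))
      ≡⟨ sum-cong-≗ (λ y → sum-cong-≗ (λ z → trans (sum-cong-≗ (rearrange y z)) (∑-*ˡ (far y * far z) (λ x → A G y x * A G x z)))) ⟩
    ∑[ y < n ] ∑[ z < n ] (far y * far z * codegree G y z)
      ≡⟨ sum-cong-≗ (λ y → trans (sum-cong-≗ (λ z → *-assoc (far y) (far z) _)) (∑-*ˡ (far y) (λ z → far z * codegree G y z))) ⟩
    ∑[ y < n ] (far y * ∑[ z < n ] (far z * codegree G y z))
      ≤⟨ ∑-mono-≤ (λ y → *-monoʳ-≤ (far y) (inner y)) ⟩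
    ∑[ y < n ] (far y * (degree G y + s))
      ≡⟨ sum-cong-≗ (λ y → trans (*-distribˡ-+ (far y) (degree G y) s) (cong (_+ far y * s) (*-comm (far y) (degree G y)))) ⟩
    ∑[ y < n ] (degree G y * far y + far y * s)
      ≡⟨ trans (∑-distrib-+ (λ y → degree G y * far y) (λ y → far y * s)) (cong (∑[ y < n ] (degree G y * far y) +_) (∑-*ʳ s far)) ⟩
    ∑[ y < n ] (degree G y * far y) + s * s ∎
    where
    open ≤-Reasoning
    reorder : ∀ p q r t → (p * q) * (r * t) ≡ p * r * (q * t)
    reorder = solve-∀
    rearrange : ∀ y z x → (far y * A G x y) * (far z * A G x z) ≡ far y * far z * (A G y x * A G x z)
    rearrange y z x rewrite A-sym G x y = reorder (far y) (A G y x) (far z) (A G x z)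
    inner : ∀ y → ∑[ z < n ] (far z * codegree G y z) ≤ degree G y + s
    inner y = ≤-trans (∑-mono-≤ pointwise)
      (≤-reflexive (trans (∑-distrib-+ (λ z → δ y z * degree G y) far) (cong (_+ s) (∑-δ y (λ _ → degree G y)))))
      where
      pointwise : ∀ z → far z * codegree G y z ≤ δ y z * degree G y + far z
      pointwise z with z Fin.≟ y
      ... | yes refl rewrite δ-refl z | codegree-self G z =
        ≤-trans (*-monoˡ-≤ (degree G z) (far≤1 z)) (m≤m+n (1 * degree G z) (far z))
      ... | no z≢y rewrite δ-≢ y z z≢y =
        ≤-trans (*-monoʳ-≤ (far z) (codegree≤1 G noEven (z≢y ∘ sym))) (≤-reflexive (*-identityʳ (far z)))

  ∑degree*far≤ : ∑[ y < n ] (degree G y * far y) ≤ Δ + s + degreeSumIn G far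
  ∑degree*far≤ = begin
    ∑[ y < n ] (degree G y * far y)                          ≤⟨ ∑-mono-≤ bound ⟩
    ∑[ y < n ] (δ v y * Δ + (far y + far y * outDegree y))
      ≡⟨ trans (∑-distrib-+ (λ y → δ v y * Δ) _) (cong₂ _+_ (∑-δ v (λ _ → Δ)) (∑-distrib-+ far (λ y → far y * outDegree y))) ⟩
    Δ + (s + degreeSumIn G far)                              ≡⟨ sym (+-assoc Δ s _) ⟩
    Δ + s + degreeSumIn G far                                ∎
    where
    open ≤-Reasoning
    bound : ∀ y → degree G y * far y ≤ δ v y * Δ + (far y + far y * outDegree y)
    bound y with y Fin.≟ v
    ... | yes refl rewrite δ-refl v | far-v = ≤-trans (≤-reflexive (trans (*-identityʳ Δ) (sym (+-identityʳ Δ)))) (m≤m+n _ _)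
    ... | no y≢v rewrite δ-≢ v y y≢v = ≤-trans (*-monoˡ-≤ (far y) (degree≤1+outDegree y≢v))
      (≤-reflexive (trans (*-distribʳ-+ (far y) 1 (outDegree y)) (cong₂ _+_ (+-identityʳ (far y)) (*-comm (outDegree y) (far y)))))

  e₂≤Δ²+4Δ+s²+16s : e₂ G ≤ Δ * Δ + 4 * Δ + s * s + 16 * s
  e₂≤Δ²+4Δ+s²+16s = begin
    e₂ G                                                           ≤⟨ e₂≤Δ²+n+2∑out+∑out² ⟩
    Δ * Δ + n + 2 * sum outDegree + ∑[ x < n ] (outDegree x * outDegree x)
      ≤⟨ +-mono-≤ (+-monoʳ-≤ (Δ * Δ + n) (*-monoʳ-≤ 2 (≤-trans (≤-reflexive ∑outDegree≡∑degree*far) D≤))) (≤-trans ∑outDegree²≤ (+-monoˡ-≤ (s * s) D≤)) ⟩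
    Δ * Δ + n + 2 * (Δ + s + 4 * s) + (Δ + s + 4 * s + s * s)
      ≡⟨ cong (λ t → Δ * Δ + t + 2 * (Δ + s + 4 * s) + (Δ + s + 4 * s + s * s)) n≡Δ+s ⟩
    Δ * Δ + (Δ + s) + 2 * (Δ + s + 4 * s) + (Δ + s + 4 * s + s * s)
      ≡⟨ collect Δ s ⟩
    Δ * Δ + 4 * Δ + s * s + 16 * s ∎
    where
    open ≤-Reasoning
    D≤ : ∑[ y < n ] (degree G y * far y) ≤ Δ + s + 4 * s
    D≤ = ≤-trans ∑degree*far≤ (+-monoʳ-≤ (Δ + s) (degreeSumIn≤4*size G noEven s far far≤1 refl))
    collect : ∀ D s → D * D + (D + s) + 2 * (D + s + 4 * s) + (D + s + 4 * s + s * s) ≡ D * D + 4 * D + s * s + 16 * s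
    collect = solve-∀

  s≤1⇒universal : s ≤ 1 → ∀ x → x ≢ v → A G v x ≡ 1
  s≤1⇒universal s≤1 x x≢v with A G v x | A≤1 G v x | two-terms≤∑ far v x (x≢v ∘ sym)
  ... | suc zero | _ | _ = refl
  ... | suc (suc _) | s≤s () | _
  ... | zero | _ | 2≤s rewrite far-v = ⊥-elim (1+n≰n (≤-trans 2≤s s≤1))

  module Universal (universal : ∀ x → x ≢ v → A G v x ≡ 1) where

    far≡δ : ∀ y → far y ≡ δ v y
    far≡δ y with y Fin.≟ v
    ... | yes refl rewrite δ-refl y = far-v
    ... | no y≢v rewrite δ-≢ v y y≢v | universal y y≢v = refl

    s≡1 : s ≡ 1
    s≡1 = trans (sum-cong-≗ far≡δ) (∑δ≡1 v)

    Δ≡m : ∀ {m} → n ≡ suc m → Δ ≡ m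
    Δ≡m n≡1+m = suc-injective (trans (+-comm 1 Δ) (trans (cong (Δ +_) (sym s≡1)) (trans (sym n≡Δ+s) n≡1+m)))

    outDegree≡1 : ∀ {x} → x ≢ v → outDegree x ≡ 1
    outDegree≡1 {x} x≢v = trans (sum-cong-≗ (λ y → cong (_* A G x y) (far≡δ y)))
      (trans (∑-δ v (A G x)) (trans (A-sym G x v) (universal x x≢v)))

    -- twice the number of edges inside the neighbourhood of v
    inner : ℕ
    inner = ∑[ x < n ] (A G v x * codegree G v x)

    degree² : ∀ x → degree G x * degree G x ≡ δ v x * (Δ * Δ) + A G v x * (1 + 3 * codegree G v x)
    degree² x with x Fin.≟ v
    ... | yes refl rewrite δ-refl x | A-irrefl G x = sym (trans (+-identityʳ _) (+-identityʳ _))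
    ... | no x≢v rewrite δ-≢ v x x≢v | universal x x≢v | degree≡codegree+outDegree x | outDegree≡1 x≢v =
      square (codegree G v x) (codegree-v≤1 x≢v)
      where
      square : ∀ c → c ≤ 1 → (c + 1) * (c + 1) ≡ 1 * (1 + 3 * c)
      square .0 z≤n = refl
      square .1 (s≤s z≤n) = refl

    e₂≡Δ²+Δ+3inner : e₂ G ≡ Δ * Δ + Δ + 3 * inner
    e₂≡Δ²+Δ+3inner = begin
      e₂ G                                                     ≡⟨ e₂≡∑degree² G ⟩
      ∑[ x < n ] (degree G x * degree G x)                    ≡⟨ sum-cong-≗ degree² ⟩
      ∑[ x < n ] (δ v x * (Δ * Δ) + A G v x * (1 + 3 * codegree G v x))
        ≡⟨ ∑-distrib-+ (λ x → δ v x * (Δ * Δ)) (λ x → A G v x * (1 + 3 * codegree G v x)) ⟩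
      ∑[ x < n ] (δ v x * (Δ * Δ)) + ∑[ x < n ] (A G v x * (1 + 3 * codegree G v x))
        ≡⟨ cong₂ _+_ (∑-δ v (λ _ → Δ * Δ)) (sum-cong-≗ (λ x → expand (A G v x) (codegree G v x))) ⟩
      Δ * Δ + ∑[ x < n ] (A G v x + 3 * (A G v x * codegree G v x))
        ≡⟨ cong (Δ * Δ +_) (trans (∑-distrib-+ (A G v) (λ x → 3 * (A G v x * codegree G v x)))
             (cong (Δ +_) (∑-*ˡ 3 (λ x → A G v x * codegree G v x)))) ⟩
      Δ * Δ + (Δ + 3 * inner)                                 ≡⟨ sym (+-assoc (Δ * Δ) Δ _) ⟩
      Δ * Δ + Δ + 3 * inner                                   ∎
      where
      open ≡-Reasoning
      expand : ∀ a c → a * (1 + 3 * c) ≡ a + 3 * (a * c)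
      expand = solve-∀

    inner-even : ∃[ k ] inner ≡ k + k
    inner-even with ∑∑-symmetric-even g g-sym g-diag
      where
      g : Fin n → Fin n → ℕ
      g x y = A G v x * (A G v y * A G y x)
      g-sym : ∀ x y → g x y ≡ g y x
      g-sym x y rewrite A-sym G y x = swap (A G v x) (A G v y) (A G x y)
        where
        swap : ∀ p q r → p * (q * r) ≡ q * (p * r)
        swap = solve-∀
      g-diag : ∀ x → g x x ≡ 0
      g-diag x rewrite A-irrefl G x = trans (cong (A G v x *_) (*-zeroʳ (A G v x))) (*-zeroʳ (A G v x))
    ... | k , ∑∑≡k+k = k , trans (sum-cong-≗ (λ x → sym (∑-*ˡ (A G v x) (λ y → A G v y * A G y x)))) ∑∑≡k+k

    inner≤Δ : inner ≤ Δ
    inner≤Δ = ∑-mono-≤ bound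
      where
      bound : ∀ x → A G v x * codegree G v x ≤ A G v x
      bound x with x Fin.≟ v
      ... | yes refl rewrite A-irrefl G x = z≤n
      ... | no x≢v = ≤-trans (*-monoʳ-≤ (A G v x) (codegree-v≤1 x≢v)) (≤-reflexive (*-identityʳ (A G v x)))

-- The extremal bound

double≤⇒≤half : ∀ {k m} → k + k ≤ m → k ≤ ⌊ m /2⌋
double≤⇒≤half {k} k+k≤m = subst (_≤ _) (sym (n≡⌊n+n/2⌋ k)) (⌊n/2⌋-mono k+k≤m)

double-half≤ : ∀ m → ⌊ m /2⌋ + ⌊ m /2⌋ ≤ m
double-half≤ m = ≤-trans (+-monoʳ-≤ ⌊ m /2⌋ (⌊n/2⌋≤⌈n/2⌉ m)) (≤-reflexive (⌊n/2⌋+⌈n/2⌉≡n m))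

≤1+double-half : ∀ m → m ≤ suc (⌊ m /2⌋ + ⌊ m /2⌋)
≤1+double-half zero = z≤n
≤1+double-half (suc zero) = s≤s z≤n
≤1+double-half (suc (suc m)) = s≤s (s≤s (≤-trans (≤1+double-half m) (≤-reflexive (sym (+-suc ⌊ m /2⌋ ⌊ m /2⌋)))))

argmax : ∀ {n} (f : Fin (suc n) → ℕ) → ∃[ v ] ∀ x → f x ≤ f v
argmax {zero} f = zero , λ { zero → ≤-refl }
argmax {suc n} f with argmax (f ∘ suc)
... | v , max with f zero ≤? f (suc v)
... | yes f0≤fv = suc v , λ { zero → f0≤fv ; (suc x) → max x }
... | no f0≰fv = zero , λ { zero → ≤-refl ; (suc x) → ≤-trans (max x) (<⇒≤ (≰⇒> f0≰fv)) }

-- e₂ of the friendship graph on m + 1 vertices: the centre has degree m, 2⌊m/2⌋ leaves degree 2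
extremal : ℕ → ℕ
extremal m = m * m + m + 3 * (⌊ m /2⌋ + ⌊ m /2⌋)

below-extremal : ∀ m e → e + 4 ≤ m * m + 4 * m → e < extremal m
below-extremal m e e+4≤ = +-cancelʳ-≤ 3 (suc e) (extremal m) (≤-trans (≤-reflexive (shift e)) (≤-trans e+4≤ m²+4m≤))
  where
  h : ℕ
  h = ⌊ m /2⌋
  shift : ∀ e → suc e + 3 ≡ e + 4
  shift = solve-∀
  m²+4m≤ : m * m + 4 * m ≤ extremal m + 3
  m²+4m≤ = ≤-trans (≤-reflexive (expand m)) (≤-trans (+-monoʳ-≤ (m * m + m) (*-monoʳ-≤ 3 (≤1+double-half m))) (≤-reflexive (collect m h)))
    where
    expand : ∀ m → m * m + 4 * m ≡ m * m + m + 3 * m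
    expand = solve-∀
    collect : ∀ m h → m * m + m + 3 * suc (h + h) ≡ m * m + m + 3 * (h + h) + 3
    collect = solve-∀

19*4n+4≤m²+4m : ∀ m → 99 ≤ m → 19 * (4 * suc m) + 4 ≤ m * m + 4 * m
19*4n+4≤m²+4m m 99≤m = begin
  19 * (4 * suc m) + 4 ≡⟨ expand m ⟩
  76 * m + 80          ≤⟨ +-monoʳ-≤ (76 * m) (≤-trans (m≤m+n 80 19) 99≤m) ⟩
  76 * m + m           ≡⟨ collect m ⟩
  77 * m               ≤⟨ *-monoˡ-≤ m (≤-trans (m≤m+n 77 22) 99≤m) ⟩
  m * m                ≤⟨ m≤m+n (m * m) (4 * m) ⟩
  m * m + 4 * m        ∎
  where
  open ≤-Reasoning
  expand : ∀ m → 19 * (4 * suc m) + 4 ≡ 76 * m + 80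
  expand = solve-∀
  collect : ∀ m → 76 * m + m ≡ 77 * m
  collect = solve-∀

Δ²+4Δ+s²+16s+4≤m²+4m : ∀ {Δ s m} → 20 ≤ Δ → 2 ≤ s → suc m ≡ Δ + s →
  Δ * Δ + 4 * Δ + s * s + 16 * s + 4 ≤ m * m + 4 * m
Δ²+4Δ+s²+16s+4≤m²+4m {m = m} 20≤Δ 2≤s 1+m≡Δ+s with ≤⇒∃+ 20≤Δ | ≤⇒∃+ 2≤s
... | α , refl | β , refl = subst (λ M → L ≤ M * M + 4 * M) (sym (suc-injective (trans 1+m≡Δ+s (regroup α β))))
  (≤-trans (m≤m+n L (5 + 2 * α + 26 * β + 2 * α * β)) (≤-reflexive (sym (expand α β))))
  where
  L : ℕ
  L = (20 + α) * (20 + α) + 4 * (20 + α) + (2 + β) * (2 + β) + 16 * (2 + β) + 4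
  regroup : ∀ a b → 20 + a + (2 + b) ≡ suc (21 + a + b)
  regroup = solve-∀
  expand : ∀ a b → (21 + a + b) * (21 + a + b) + 4 * (21 + a + b) ≡
    (20 + a) * (20 + a) + 4 * (20 + a) + (2 + b) * (2 + b) + 16 * (2 + b) + 4 + (5 + 2 * a + 26 * b + 2 * a * b)
  expand = solve-∀

-- v is adjacent to all other vertices, and at most one of them has no neighbour besides v
FriendshipLike : ∀ {n} → Graph n → Set
FriendshipLike {n} G = ∃[ v ] (∀ x → x ≢ v → A G v x ≡ 1) × ∑[ x < n ] (A G v x * (1 ∸ codegree G v x)) ≤ 1

module ExtremalBound (m : ℕ) (99≤m : 99 ≤ m) (G : Graph (suc m)) (noEven : EvenCycleFree G) where

  Bounded : Set
  Bounded = e₂ G ≤ extremal m × (e₂ G ≡ extremal m → FriendshipLike G)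

  strict⇒bounded : e₂ G + 4 ≤ m * m + 4 * m → Bounded
  strict⇒bounded e₂+4≤ = <⇒≤ e₂<ext , λ e₂≡ext → ⊥-elim (<-irrefl e₂≡ext e₂<ext)
    where
    e₂<ext : e₂ G < extremal m
    e₂<ext = below-extremal m (e₂ G) e₂+4≤

  ∑degree≤4n : ∑[ x < suc m ] degree G x ≤ 4 * suc m
  ∑degree≤4n = subst (_≤ 4 * suc m) (sum-cong-≗ (λ x → trans (+-identityʳ _) (sum-cong-≗ (λ y → +-identityʳ (A G x y)))))
    (degreeSumIn≤4*size G noEven (suc m) (λ _ → 1) (λ _ → s≤s z≤n) (∑-count (suc m)))

  maxDegree≤19⇒e₂+4≤m²+4m : (∀ x → degree G x ≤ 19) → e₂ G + 4 ≤ m * m + 4 * m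
  maxDegree≤19⇒e₂+4≤m²+4m degree≤19 = ≤-trans (+-monoˡ-≤ 4 e₂≤) (19*4n+4≤m²+4m m 99≤m)
    where
    e₂≤ : e₂ G ≤ 19 * (4 * suc m)
    e₂≤ = begin
      e₂ G                                   ≡⟨ e₂≡∑degree² G ⟩
      ∑[ x < suc m ] (degree G x * degree G x) ≤⟨ ∑-mono-≤ (λ x → *-monoˡ-≤ (degree G x) (degree≤19 x)) ⟩
      ∑[ x < suc m ] (19 * degree G x)       ≡⟨ ∑-*ˡ 19 (degree G) ⟩
      19 * ∑[ x < suc m ] degree G x         ≤⟨ *-monoʳ-≤ 19 ∑degree≤4n ⟩
      19 * (4 * suc m)                       ∎
      where open ≤-Reasoning

  module _ (v : Fin (suc m)) where
    open Neighbourhood G noEven v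

    far≥2⇒e₂+4≤m²+4m : 20 ≤ Δ → 2 ≤ s → e₂ G + 4 ≤ m * m + 4 * m
    far≥2⇒e₂+4≤m²+4m 20≤Δ 2≤s = ≤-trans (+-monoˡ-≤ 4 e₂≤Δ²+4Δ+s²+16s) (Δ²+4Δ+s²+16s+4≤m²+4m 20≤Δ 2≤s n≡Δ+s)

    -- e₂ G = m² + m + 3 · inner with inner even and ≤ m; equality forces inner = 2⌊m/2⌋ ≥ m - 1
    universal⇒bounded : (∀ x → x ≢ v → A G v x ≡ 1) → Bounded
    universal⇒bounded isUniversal = e₂≤ext , e₂≡ext⇒
      where
      open Universal isUniversal
      Δ=m : Δ ≡ m
      Δ=m = Δ≡m refl
      k h : ℕ
      k = proj₁ inner-even
      h = ⌊ m /2⌋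
      e₂≡ : e₂ G ≡ m * m + m + 3 * (k + k)
      e₂≡ = trans e₂≡Δ²+Δ+3inner (trans (cong (λ t → t * t + t + 3 * inner) Δ=m) (cong (λ t → m * m + m + 3 * t) (proj₂ inner-even)))
      k≤h : k ≤ h
      k≤h = double≤⇒≤half (≤-trans (≤-reflexive (sym (proj₂ inner-even))) (≤-trans inner≤Δ (≤-reflexive Δ=m)))
      e₂≤ext : e₂ G ≤ extremal m
      e₂≤ext = ≤-trans (≤-reflexive e₂≡) (+-monoʳ-≤ (m * m + m) (*-monoʳ-≤ 3 (+-mono-≤ k≤h k≤h)))
      e₂≡ext⇒ : e₂ G ≡ extremal m → FriendshipLike G
      e₂≡ext⇒ e₂≡ext = v , isUniversal , few
        where
        k+k≡h+h : k + k ≡ h + h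
        k+k≡h+h = *-cancelˡ-≡ (k + k) (h + h) 3 (+-cancelˡ-≡ (m * m + m) _ _ (trans (sym e₂≡) e₂≡ext))
        split : ∀ x → A G v x * (1 ∸ codegree G v x) + A G v x * codegree G v x ≡ A G v x
        split x with x Fin.≟ v
        ... | yes refl rewrite A-irrefl G x = refl
        ... | no x≢v = trans (sym (*-distribˡ-+ (A G v x) _ _)) (trans (cong (A G v x *_) (m∸n+n≡m (codegree-v≤1 x≢v))) (*-identityʳ (A G v x)))
        lonely : ℕ
        lonely = ∑[ x < suc m ] (A G v x * (1 ∸ codegree G v x))
        total : lonely + (h + h) ≡ m
        total = begin
          lonely + (h + h) ≡⟨ cong (lonely +_) (trans (sym k+k≡h+h) (sym (proj₂ inner-even))) ⟩
          lonely + inner   ≡⟨ ∑-distrib-+ (λ x → A G v x * (1 ∸ codegree G v x)) (λ x → A G v x * codegree G v x) ⟨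
          ∑[ x < suc m ] (A G v x * (1 ∸ codegree G v x) + A G v x * codegree G v x) ≡⟨ sum-cong-≗ split ⟩
          Δ                ≡⟨ Δ=m ⟩
          m                ∎
          where open ≡-Reasoning
        few : lonely ≤ 1
        few = +-cancelʳ-≤ (h + h) lonely 1 (≤-trans (≤-reflexive total) (≤1+double-half m))

  bounded : Bounded
  bounded with argmax (degree G)
  ... | v , max with 20 ≤? Neighbourhood.Δ G noEven v | 2 ≤? Neighbourhood.s G noEven v
  ... | no Δ≱20 | _ = strict⇒bounded (maxDegree≤19⇒e₂+4≤m²+4m (λ x → ≤-trans (max x) (≤-pred (≰⇒> Δ≱20))))
  ... | yes 20≤Δ | yes 2≤s = strict⇒bounded (far≥2⇒e₂+4≤m²+4m v 20≤Δ 2≤s)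
  ... | yes _ | no s≱2 = universal⇒bounded v (Neighbourhood.s≤1⇒universal G noEven v (≤-pred (≰⇒> s≱2)))

-- The friendship graph

fadj-leaves⇒ : ∀ a b → fadj (suc a) (suc b) ≡ true → ⌊ a /2⌋ ≡ ⌊ b /2⌋ × a ≢ b
fadj-leaves⇒ a b ab with Equivalence.to T-∧ (Equivalence.from T-≡ ab)
... | same , distinct = ≡ᵇ⇒≡ _ _ same , λ a≡b → subst T (cong not (Equivalence.to T-≡ (≡⇒≡ᵇ a b a≡b))) distinct

≢⇒≡ᵇ-false : ∀ a b → a ≢ b → (a ≡ᵇ b) ≡ false
≢⇒≡ᵇ-false a b a≢b with a ≡ᵇ b in eq
... | true = ⊥-elim (a≢b (≡ᵇ⇒≡ a b (subst T (sym eq) _)))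
... | false = refl

⇒fadj-leaves : ∀ a b → ⌊ a /2⌋ ≡ ⌊ b /2⌋ → a ≢ b → fadj (suc a) (suc b) ≡ true
⇒fadj-leaves a b same distinct rewrite Equivalence.to T-≡ (≡⇒≡ᵇ _ _ same) | ≢⇒≡ᵇ-false a b distinct = refl

leaf-partner-unique : ∀ a b c → fadj (suc a) (suc b) ≡ true → fadj (suc a) (suc c) ≡ true → b ≡ c
leaf-partner-unique zero (suc zero) (suc zero) _ _ = refl
leaf-partner-unique zero zero _ () _
leaf-partner-unique zero (suc (suc b)) _ () _
leaf-partner-unique zero (suc zero) zero _ ()
leaf-partner-unique zero (suc zero) (suc (suc c)) _ ()
leaf-partner-unique (suc zero) zero zero _ _ = refl
leaf-partner-unique (suc zero) (suc zero) _ () _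
leaf-partner-unique (suc zero) (suc (suc b)) _ () _
leaf-partner-unique (suc zero) zero (suc zero) _ ()
leaf-partner-unique (suc zero) zero (suc (suc c)) _ ()
leaf-partner-unique (suc (suc a)) zero _ () _
leaf-partner-unique (suc (suc a)) (suc zero) _ () _
leaf-partner-unique (suc (suc a)) (suc (suc b)) zero _ ()
leaf-partner-unique (suc (suc a)) (suc (suc b)) (suc zero) _ ()
leaf-partner-unique (suc (suc a)) (suc (suc b)) (suc (suc c)) ab ac = cong (2 +_) (leaf-partner-unique a b c ab ac)

module _ (n : ℕ) where

  F : Graph n
  F = Friendship n

  Leaf : Fin n → Set
  Leaf x = toℕ x ≢ 0

  leaf-neighbours-equal : ∀ {x y z} → Leaf x → Leaf y → Leaf z → adj F x y ≡ true → adj F x z ≡ true → y ≡ z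
  leaf-neighbours-equal {x} {y} {z} x≢0 y≢0 z≢0 xy xz with toℕ x | toℕ y in ey | toℕ z in ez
  ... | zero | _ | _ = ⊥-elim (x≢0 refl)
  ... | _ | zero | _ = ⊥-elim (y≢0 refl)
  ... | _ | _ | zero = ⊥-elim (z≢0 refl)
  ... | suc a | suc b | suc c = toℕ-injective (trans ey (trans (cong suc (leaf-partner-unique a b c xy xz)) (sym ez)))

  -- any cycle of length ≥ 4 has three consecutive leaves, and a leaf has only one leaf neighbour
  noLongCycle : ∀ t → ¬ HasCycle F (4 + t)
  noLongCycle t (_ , c , inj , path , closing) = contradiction
    where
    last : Fin (4 + t)
    last = fromℕ (3 + t)
    beforeLast : Fin (4 + t)
    beforeLast = inject₁ (fromℕ (2 + t))
    centre-once : ∀ i j → toℕ (c i) ≡ 0 → i ≢ j → Leaf (c j)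
    centre-once i j ci≡0 i≢j cj≡0 = i≢j (inj (toℕ-injective (trans ci≡0 (sym cj≡0))))
    middle : ∀ {i j k} → i ≢ k → Leaf (c i) → Leaf (c j) → Leaf (c k) →
      adj F (c j) (c i) ≡ true → adj F (c j) (c k) ≡ true → ⊥
    middle i≢k i-leaf j-leaf k-leaf ji jk = i≢k (inj (leaf-neighbours-equal j-leaf i-leaf k-leaf ji jk))
    toℕ-≢ : ∀ {i j : Fin (4 + t)} → toℕ i ≢ toℕ j → i ≢ j
    toℕ-≢ ne refl = ne refl
    toℕ-beforeLast : toℕ beforeLast ≡ 2 + t
    toℕ-beforeLast = trans (toℕ-inject₁ (fromℕ (2 + t))) (toℕ-fromℕ (2 + t))
    1≢beforeLast : suc zero ≢ beforeLast
    1≢beforeLast = toℕ-≢ (λ e → 0≢1+n (cong pred (trans e toℕ-beforeLast)))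
    1≢last : suc zero ≢ last
    1≢last = toℕ-≢ (λ e → 0≢1+n (cong pred (trans e (toℕ-fromℕ (3 + t)))))
    contradiction : ⊥
    contradiction with toℕ (c zero) ≟ 0 | toℕ (c (suc zero)) ≟ 0 | toℕ (c last) ≟ 0
    ... | yes c₀≡0 | _ | _ = middle {suc zero} {suc (suc zero)} {suc (suc (suc zero))} (λ ())
      (centre-once zero _ c₀≡0 (λ ())) (centre-once zero _ c₀≡0 (λ ())) (centre-once zero _ c₀≡0 (λ ()))
      (adj-sym F {c (suc zero)} {c (suc (suc zero))} (path (suc zero))) (path (suc (suc zero)))
    ... | no c₀≢0 | yes c₁≡0 | _ = middle {beforeLast} {last} {zero} (toℕ-≢ (λ e → 0≢1+n (sym (trans (sym toℕ-beforeLast) e))))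
      (centre-once (suc zero) beforeLast c₁≡0 1≢beforeLast) (centre-once (suc zero) last c₁≡0 1≢last) c₀≢0
      (adj-sym F {c beforeLast} {c last} (path (fromℕ (2 + t)))) closing
    ... | no c₀≢0 | no c₁≢0 | yes cₗ≡0 = middle {zero} {suc zero} {suc (suc zero)} (λ ())
      c₀≢0 c₁≢0 (centre-once last (suc (suc zero)) cₗ≡0 (toℕ-≢ (λ e → 0≢1+n (sym (cong (pred ∘ pred) (trans (sym (toℕ-fromℕ (3 + t))) e))))))
      (adj-sym F {c zero} {c (suc zero)} (path zero)) (path (suc zero))
    ... | no c₀≢0 | no c₁≢0 | no cₗ≢0 = middle {suc zero} {zero} {last} 1≢last c₁≢0 c₀≢0 cₗ≢0
      (path zero) (adj-sym F {c last} {c zero} closing)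

  friendship-evenCycleFree : EvenCycleFree F
  friendship-evenCycleFree zero ()
  friendship-evenCycleFree (suc zero) (s≤s (s≤s ()) , _)
  friendship-evenCycleFree (suc (suc k)) cycle = noLongCycle (k + (k + 0)) (subst (HasCycle F) 2k+4≡ cycle)
    where
    2k+4≡ : 2 * suc (suc k) ≡ 4 + (k + (k + 0))
    2k+4≡ = cong (2 +_) (trans (+-suc k (suc (k + 0))) (cong suc (+-suc k (k + 0))))

leafPartner : ℕ → ℕ
leafPartner zero = 1
leafPartner (suc zero) = 0
leafPartner (suc (suc a)) = 2 + leafPartner a

leafPartner-adj : ∀ a → fadj (suc (leafPartner a)) (suc a) ≡ true
leafPartner-adj zero = refl
leafPartner-adj (suc zero) = refl
leafPartner-adj (suc (suc a)) = leafPartner-adj a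

leafPartner<double : ∀ a k → a < k + k → leafPartner a < k + k
leafPartner<double zero (suc k) _ = s≤s (subst (1 ≤_) (sym (+-suc k k)) (s≤s z≤n))
leafPartner<double (suc zero) (suc k) _ = s≤s z≤n
leafPartner<double (suc (suc a)) (suc k) (s≤s a<2k) rewrite +-suc k k =
  s≤s (s≤s (leafPartner<double a k (s≤s⁻¹ a<2k)))

module _ (m : ℕ) where
  open Neighbourhood (Friendship (suc m)) (friendship-evenCycleFree (suc m)) zero

  centre-universal : ∀ x → x ≢ zero → A (Friendship (suc m)) zero x ≡ 1
  centre-universal zero x≢0 = ⊥-elim (x≢0 refl)
  centre-universal (suc x) _ = refl

  open Universal centre-universal

  matched : ∀ (i : Fin m) → toℕ i < ⌊ m /2⌋ + ⌊ m /2⌋ → 1 ≤ codegree (Friendship (suc m)) zero (suc i)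
  matched i i<2h = ≤-trans (≤-reflexive (sym leafPartner-term)) (term≤∑ (λ y → A (Friendship (suc m)) zero y * A (Friendship (suc m)) y (suc i)) (suc j))
    where
    leafPartner<m : leafPartner (toℕ i) < m
    leafPartner<m = ≤-trans (leafPartner<double (toℕ i) ⌊ m /2⌋ i<2h) (double-half≤ m)
    j : Fin m
    j = fromℕ< leafPartner<m
    leafPartner-term : A (Friendship (suc m)) zero (suc j) * A (Friendship (suc m)) (suc j) (suc i) ≡ 1
    leafPartner-term rewrite toℕ-fromℕ< leafPartner<m | leafPartner-adj (toℕ i) = refl

  double-half≤inner : ⌊ m /2⌋ + ⌊ m /2⌋ ≤ inner
  double-half≤inner = ≤-trans (≤-reflexive (sym (∑-initialSegment m (h + h) (double-half≤ m))))
    (≤-trans (∑-mono-≤ initial≤) (m≤n+m _ _))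
    where
    h : ℕ
    h = ⌊ m /2⌋
    initial≤ : ∀ i → (if toℕ i <ᵇ h + h then 1 else 0) ≤ A (Friendship (suc m)) zero (suc i) * codegree (Friendship (suc m)) zero (suc i)
    initial≤ i with toℕ i <ᵇ h + h in i<ᵇ2h
    ... | false = z≤n
    ... | true = ≤-trans (matched i (<ᵇ⇒< (toℕ i) (h + h) (subst T (sym i<ᵇ2h) _))) (≤-reflexive (sym (+-identityʳ _)))

  extremal≤e₂-friendship : extremal m ≤ e₂ (Friendship (suc m))
  extremal≤e₂-friendship = ≤-trans (+-monoʳ-≤ (m * m + m) (*-monoʳ-≤ 3 double-half≤inner))
    (≤-reflexive (sym (trans e₂≡Δ²+Δ+3inner (cong (λ t → t * t + t + 3 * inner) (Δ≡m refl)))))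

-- Friendship-like graphs are friendship graphs

injective⇒surjective : ∀ {n} (f : Fin n → Fin n) → Injective _≡_ _≡_ f → ∀ y → ∃[ x ] f x ≡ y
injective⇒surjective {suc n} f f-inj y with any? (λ x → f x Fin.≟ y)
... | yes found = found
... | no missed = ⊥-elim (<-irrefl refl (injective⇒≤ {f = λ x → punchOut (missed′ x)}
        (λ {a} {b} eq → f-inj (punchOut-injective (missed′ a) (missed′ b) eq))))
  where
  missed′ : ∀ x → y ≢ f x
  missed′ x y≡fx = missed (x , sym y≡fx)

injective⇒permutation : ∀ {n} (f : Fin n → Fin n) → Injective _≡_ _≡_ f →
  Σ[ σ ∈ Permutation′ n ] ∀ i → σ ⟨$⟩ʳ i ≡ f i
injective⇒permutation f f-inj = mk↔ₛ′ f (proj₁ ∘ surjective) (proj₂ ∘ surjective) (λ x → f-inj (proj₂ (surjective (f x)))) , λ _ → refl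
  where
  surjective : ∀ y → ∃[ x ] f x ≡ y
  surjective = injective⇒surjective f f-inj

bool-ext : ∀ {b c : Bool} → (b ≡ true → c ≡ true) → (c ≡ true → b ≡ true) → b ≡ c
bool-ext {true} {true} _ _ = refl
bool-ext {false} {false} _ _ = refl
bool-ext {true} {false} b⇒c _ = sym (b⇒c refl)
bool-ext {false} {true} _ c⇒b = c⇒b refl

even-double : ∀ k → even (k + k) ≡ true
even-double zero = refl
even-double (suc k) = trans (cong (even ∘ suc) (+-suc k k)) (even-double k)

odd≢even : ∀ a b → suc (a + a) ≢ suc (suc (b + b))
odd≢even a b eq = true≢false (begin
  true                ≡⟨ even-double a ⟨
  even (a + a)        ≡⟨ cong even (suc-injective eq) ⟩
  even (suc (b + b))  ≡⟨ even-suc (b + b) ⟩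
  not (even (b + b))  ≡⟨ cong not (even-double b) ⟩
  false               ∎)
  where open ≡-Reasoning

⌊1+2k/2⌋≡k : ∀ k → ⌊ suc (k + k) /2⌋ ≡ k
⌊1+2k/2⌋≡k zero = refl
⌊1+2k/2⌋≡k (suc k) = trans (cong (λ t → ⌊ suc (suc t) /2⌋) (+-suc k k)) (cong suc (⌊1+2k/2⌋≡k k))

⌊2k/2⌋≡k : ∀ k → ⌊ k + k /2⌋ ≡ k
⌊2k/2⌋≡k k = sym (n≡⌊n+n/2⌋ k)

double-injective : ∀ {a b} → a + a ≡ b + b → a ≡ b
double-injective {a} {b} eq = trans (sym (⌊2k/2⌋≡k a)) (trans (cong ⌊_/2⌋ eq) (⌊2k/2⌋≡k b))

module FriendshipIsomorphism (m : ℕ) (G : Graph (suc m)) (noEven : EvenCycleFree G) (v : Fin (suc m))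
  (universal : ∀ x → x ≢ v → A G v x ≡ 1)
  (fewSingles : ∑[ x < suc m ] (A G v x * (1 ∸ codegree G v x)) ≤ 1) where

  leaf : Fin (suc m) → ℕ
  leaf x = A G v x

  edge : Fin (suc m) → Fin (suc m) → ℕ
  edge x w = leaf x * leaf w * A G x w

  below : Fin (suc m) → Fin (suc m) → ℕ
  below x w = fromBool (toℕ x <ᵇ toℕ w)

  leafDegree isFirst isSecond rank partnerRank isSingle : Fin (suc m) → ℕ
  leafDegree x = sum (edge x)
  isFirst x = ∑[ w < suc m ] (edge x w * below x w)
  isSecond x = ∑[ w < suc m ] (edge x w * below w x)
  rank x = ∑[ z < suc m ] (isFirst z * below z x)
  partnerRank x = ∑[ w < suc m ] (edge x w * rank w)
  isSingle x = leaf x * (1 ∸ leafDegree x)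

  pairs : ℕ
  pairs = sum isFirst

  -- v gets 0; the leaf edge whose first end has rank k gets 2k + 1 and 2k + 2; a single leaf gets 2 pairs + 1
  label : Fin (suc m) → ℕ
  label x = isFirst x * suc (rank x + rank x) + isSecond x * suc (suc (partnerRank x + partnerRank x))
    + isSingle x * suc (pairs + pairs)

  leaf-v : leaf v ≡ 0
  leaf-v = A-irrefl G v

  edge-sym : ∀ x w → edge x w ≡ edge w x
  edge-sym x w rewrite A-sym G x w = swap (leaf x) (leaf w) (A G w x)
    where
    swap : ∀ p q r → p * q * r ≡ q * p * r
    swap = solve-∀

  edge≤1 : ∀ x w → edge x w ≤ 1
  edge≤1 x w = bit*bit≤1 (bit*bit≤1 (A≤1 G v x) (A≤1 G v w)) (A≤1 G x w)

  edge-from-v : ∀ w → edge v w ≡ 0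
  edge-from-v w rewrite leaf-v = refl

  edge-to-v : ∀ x → edge x v ≡ 0
  edge-to-v x rewrite leaf-v = cong (_* A G x v) (*-zeroʳ (leaf x))

  edge-self : ∀ x → edge x x ≡ 0
  edge-self x rewrite A-irrefl G x = *-zeroʳ (leaf x * leaf x)

  edge≡1⇒adj : ∀ {i j} → edge i j ≡ 1 → adj G i j ≡ true
  edge≡1⇒adj {i} {j} e = 1≤A⇒adj G (proj₂ (1≤m*n⇒1≤m×1≤n (leaf i * leaf j) (A G i j) (≤-reflexive (sym e))))

  adj⇒edge≡1 : ∀ {i j} → i ≢ v → j ≢ v → adj G i j ≡ true → edge i j ≡ 1
  adj⇒edge≡1 {i} {j} i≢v j≢v ij rewrite universal i i≢v | universal j j≢v | ij = refl

  below-irrefl : ∀ x → below x x ≡ 0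
  below-irrefl x with toℕ x <ᵇ toℕ x | <ᵇ-reflects-< (toℕ x) (toℕ x)
  ... | true | ofʸ x<x = ⊥-elim (<-irrefl refl x<x)
  ... | false | _ = refl

  below≡1 : ∀ {x w} → toℕ x < toℕ w → below x w ≡ 1
  below≡1 {x} {w} x<w with toℕ x <ᵇ toℕ w | <ᵇ-reflects-< (toℕ x) (toℕ w)
  ... | true | _ = refl
  ... | false | ofⁿ x≮w = ⊥-elim (x≮w x<w)

  below≡0 : ∀ {x w} → toℕ w < toℕ x → below x w ≡ 0
  below≡0 {x} {w} w<x with toℕ x <ᵇ toℕ w | <ᵇ-reflects-< (toℕ x) (toℕ w)
  ... | true | ofʸ x<w = ⊥-elim (<-asym x<w w<x)
  ... | false | _ = refl

  below≤1 : ∀ x w → below x w ≤ 1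
  below≤1 x w = fromBool≤1 (toℕ x <ᵇ toℕ w)

  leafDegree≡codegree : ∀ {x} → x ≢ v → leafDegree x ≡ codegree G v x
  leafDegree≡codegree {x} x≢v = sum-cong-≗ (λ w → trans (cong (λ t → t * leaf w * A G x w) (universal x x≢v))
      (trans (cong (_* A G x w) (+-identityʳ (leaf w))) (cong (leaf w *_) (A-sym G x w))))

  leafDegree≤1 : ∀ {x} → x ≢ v → leafDegree x ≤ 1
  leafDegree≤1 {x} x≢v = subst (_≤ 1) (sym (leafDegree≡codegree x≢v)) (codegree≤1 G noEven (x≢v ∘ sym))

  record Partner (x w : Fin (suc m)) : Set where
    constructor partnered
    field edge≡δ : ∀ z → edge x z ≡ δ w z
  open Partner

  single-or-matched : ∀ {x} → x ≢ v → (∀ w → edge x w ≡ 0) ⊎ ∃ (Partner x)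
  single-or-matched {x} x≢v with any? (λ w → 1 ≤? edge x w)
  ... | no none = inj₁ (λ w → n≤0⇒n≡0 (≤-pred (≰⇒> (λ 1≤e → none (w , 1≤e)))))
  ... | yes (w , 1≤xw) = inj₂ (w , partnered partner)
    where
    partner : ∀ z → edge x z ≡ δ w z
    partner z with z Fin.≟ w
    ... | yes refl = trans (≤-antisym (edge≤1 x z) 1≤xw) (sym (δ-refl z))
    ... | no z≢w rewrite δ-≢ w z z≢w = n≤0⇒n≡0 (+-cancelˡ-≤ 1 (edge x z) 0
      (≤-trans (+-monoˡ-≤ (edge x z) 1≤xw) (≤-trans (two-terms≤∑ (edge x) w z (z≢w ∘ sym)) (leafDegree≤1 x≢v))))

  data Role (x : Fin (suc m)) : Set where
    centre : x ≡ v → Role x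
    single : x ≢ v → (∀ w → edge x w ≡ 0) → Role x
    first : ∀ w → x ≢ v → Partner x w → toℕ x < toℕ w → Role x
    second : ∀ w → x ≢ v → Partner x w → toℕ w < toℕ x → Role x

  role : ∀ x → Role x
  role x with x Fin.≟ v
  ... | yes x≡v = centre x≡v
  ... | no x≢v with single-or-matched x≢v
  ... | inj₁ alone = single x≢v alone
  ... | inj₂ (w , partner) with <-cmp (toℕ x) (toℕ w)
  ... | tri< x<w _ _ = first w x≢v partner x<w
  ... | tri> _ _ w<x = second w x≢v partner w<x
  ... | tri≈ _ x≡w _ = ⊥-elim (0≢1+n (trans (sym (edge-self x)) (trans (edge≡δ partner x) (trans (cong (δ w) (toℕ-injective x≡w)) (δ-refl w)))))

  ∑edge-alone : ∀ (f : Fin (suc m) → ℕ) {x} → (∀ w → edge x w ≡ 0) → ∑[ w < suc m ] (edge x w * f w) ≡ 0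
  ∑edge-alone f alone = trans (sum-cong-≗ (λ w → cong (_* f w) (alone w))) (sum-replicate-zero (suc m))

  ∑edge-partner : ∀ (f : Fin (suc m) → ℕ) {x w} → Partner x w → ∑[ z < suc m ] (edge x z * f z) ≡ f w
  ∑edge-partner f {w = w} partner = trans (sum-cong-≗ (λ z → cong (_* f z) (edge≡δ partner z))) (∑-δ w f)

  leafDegree-partner : ∀ {x w} → Partner x w → leafDegree x ≡ 1
  leafDegree-partner {w = w} partner = trans (sum-cong-≗ (edge≡δ partner)) (∑δ≡1 w)

  partner-symmetric : ∀ {x w} → Partner x w → w ≢ v × Partner w x
  partner-symmetric {x} {w} partner = w≢v , partner′
    where
    x~w : edge x w ≡ 1
    x~w = trans (edge≡δ partner w) (δ-refl w)
    w≢v : w ≢ v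
    w≢v refl = 0≢1+n (trans (sym (edge-to-v x)) x~w)
    partner′ : Partner w x
    partner′ with single-or-matched w≢v
    ... | inj₁ alone = ⊥-elim (0≢1+n (trans (sym (alone x)) (trans (edge-sym w x) x~w)))
    ... | inj₂ (x′ , partner″) = subst (Partner w) (sym x≡x′) partner″
      where
      x≡x′ : x ≡ x′
      x≡x′ = δ≡1⇒≡ x′ x (trans (sym (edge≡δ partner″ x)) (trans (edge-sym w x) x~w))

  same-partner : ∀ {x y w} → Partner x w → Partner y w → x ≡ y
  same-partner {x} {y} {w} x-w y-w = sym (δ≡1⇒≡ x y (trans (sym (edge≡δ (proj₂ (partner-symmetric x-w)) y))
    (trans (edge-sym w y) (trans (edge≡δ y-w w) (δ-refl w)))))

  isFirst-centre : isFirst v ≡ 0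
  isFirst-centre = ∑edge-alone (below v) edge-from-v
  isSecond-centre : isSecond v ≡ 0
  isSecond-centre = ∑edge-alone (λ w → below w v) edge-from-v
  isSingle-centre : isSingle v ≡ 0
  isSingle-centre rewrite leaf-v = refl

  isFirst-single : ∀ {x} → (∀ w → edge x w ≡ 0) → isFirst x ≡ 0
  isFirst-single {x} = ∑edge-alone (below x)
  isSecond-single : ∀ {x} → (∀ w → edge x w ≡ 0) → isSecond x ≡ 0
  isSecond-single {x} = ∑edge-alone (λ w → below w x)
  isSingle-single : ∀ {x} → x ≢ v → (∀ w → edge x w ≡ 0) → isSingle x ≡ 1
  isSingle-single {x} x≢v alone rewrite trans (sum-cong-≗ alone) (sum-replicate-zero (suc m)) | universal x x≢v = refl

  isFirst-partner : ∀ {x w} → Partner x w → isFirst x ≡ below x w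
  isFirst-partner {x} = ∑edge-partner (below x)
  isSecond-partner : ∀ {x w} → Partner x w → isSecond x ≡ below w x
  isSecond-partner {x} = ∑edge-partner (λ w → below w x)
  isSingle-partner : ∀ {x w} → Partner x w → isSingle x ≡ 0
  isSingle-partner {x} partner rewrite leafDegree-partner partner = *-zeroʳ (leaf x)

  isFirst-first : ∀ {x w} → Partner x w → toℕ x < toℕ w → isFirst x ≡ 1
  isFirst-first partner x<w = trans (isFirst-partner partner) (below≡1 x<w)

  isFirst-second : ∀ {x w} → Partner x w → toℕ w < toℕ x → isFirst w ≡ 1
  isFirst-second partner w<x = isFirst-first (proj₂ (partner-symmetric partner)) w<x

  label-centre : label v ≡ 0
  label-centre rewrite isFirst-centre | isSecond-centre | isSingle-centre = refl

  label-single : ∀ {x} → x ≢ v → (∀ w → edge x w ≡ 0) → label x ≡ suc (pairs + pairs)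
  label-single x≢v alone rewrite isFirst-single alone | isSecond-single alone | isSingle-single x≢v alone =
    +-identityʳ _

  label-first : ∀ {x w} → Partner x w → toℕ x < toℕ w → label x ≡ suc (rank x + rank x)
  label-first partner x<w rewrite isFirst-partner partner | isSecond-partner partner | isSingle-partner partner
    | below≡1 x<w | below≡0 x<w = trans (+-identityʳ _) (trans (+-identityʳ _) (+-identityʳ _))

  label-second : ∀ {x w} → Partner x w → toℕ w < toℕ x → label x ≡ suc (suc (rank w + rank w))
  label-second {x} partner w<x rewrite isFirst-partner partner | isSecond-partner partner | isSingle-partner partner
    | below≡0 w<x | below≡1 w<x | ∑edge-partner rank partner = trans (+-identityʳ _) (+-identityʳ _)

  below-mono : ∀ {z x} y → toℕ z < toℕ x → below y z ≤ below y x
  below-mono {z} {x} y z<x with toℕ y <ᵇ toℕ z | <ᵇ-reflects-< (toℕ y) (toℕ z)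
  ... | true | ofʸ y<z = ≤-reflexive (sym (below≡1 (<-trans y<z z<x)))
  ... | false | _ = z≤n

  rank-mono : ∀ {z x} → isFirst z ≡ 1 → toℕ z < toℕ x → rank z < rank x
  rank-mono {z} {x} first-z z<x = ∑-mono-< z (λ y → *-monoʳ-≤ (isFirst y) (below-mono y z<x)) at-z
    where
    at-z : isFirst z * below z z < isFirst z * below z x
    at-z rewrite below-irrefl z | below≡1 z<x | first-z = ≤-refl

  rank<pairs : ∀ {x} → isFirst x ≡ 1 → rank x < pairs
  rank<pairs {x} first-x = ∑-mono-< x (λ y → ≤-trans (*-monoʳ-≤ (isFirst y) (below≤1 y x)) (≤-reflexive (*-identityʳ (isFirst y)))) at-x
    where
    at-x : isFirst x * below x x < isFirst x
    at-x rewrite below-irrefl x | first-x = ≤-refl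

  rank-injective : ∀ {x y} → isFirst x ≡ 1 → isFirst y ≡ 1 → rank x ≡ rank y → x ≡ y
  rank-injective {x} {y} first-x first-y rx≡ry with <-cmp (toℕ x) (toℕ y)
  ... | tri< x<y _ _ = ⊥-elim (<-irrefl rx≡ry (rank-mono first-x x<y))
  ... | tri≈ _ x≡y _ = toℕ-injective x≡y
  ... | tri> _ _ y<x = ⊥-elim (<-irrefl (sym rx≡ry) (rank-mono first-y y<x))

  leaf+δ≡1 : ∀ x → leaf x + δ v x ≡ 1
  leaf+δ≡1 x with x Fin.≟ v
  ... | yes refl rewrite leaf-v | δ-refl x = refl
  ... | no x≢v rewrite universal x x≢v | δ-≢ v x x≢v = refl

  ∑leaf≡m : sum leaf ≡ m
  ∑leaf≡m = suc-injective (begin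
    suc (sum leaf)               ≡⟨ +-comm 1 (sum leaf) ⟩
    sum leaf + 1                 ≡⟨ cong (sum leaf +_) (∑δ≡1 v) ⟨
    sum leaf + sum (δ v)         ≡⟨ ∑-distrib-+ leaf (δ v) ⟨
    ∑[ x < suc m ] (leaf x + δ v x) ≡⟨ sum-cong-≗ leaf+δ≡1 ⟩
    ∑[ x < suc m ] 1             ≡⟨ ∑-count (suc m) ⟩
    suc m                        ∎)
    where open ≡-Reasoning

  leaf≡first+second+single : ∀ x → leaf x ≡ isFirst x + isSecond x + isSingle x
  leaf≡first+second+single x with role x
  ... | centre refl rewrite isFirst-centre | isSecond-centre | isSingle-centre = leaf-v
  ... | single x≢v alone rewrite isFirst-single alone | isSecond-single alone | isSingle-single x≢v alone = universal x x≢v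
  ... | first w x≢v partner x<w rewrite isFirst-partner partner | isSecond-partner partner | isSingle-partner partner
    | below≡1 x<w | below≡0 x<w = universal x x≢v
  ... | second w x≢v partner w<x rewrite isFirst-partner partner | isSecond-partner partner | isSingle-partner partner
    | below≡0 w<x | below≡1 w<x = universal x x≢v

  ∑isSecond≡pairs : sum isSecond ≡ pairs
  ∑isSecond≡pairs = trans (∑-comm (λ x w → edge x w * below w x))
    (sum-cong-≗ (λ w → sum-cong-≗ (λ x → cong (_* below w x) (edge-sym x w))))

  ∑isSingle≤1 : sum isSingle ≤ 1
  ∑isSingle≤1 = ≤-trans (≤-reflexive (sum-cong-≗ isSingle≡)) fewSingles
    where
    isSingle≡ : ∀ x → isSingle x ≡ A G v x * (1 ∸ codegree G v x)
    isSingle≡ x with x Fin.≟ v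
    ... | yes refl rewrite leaf-v = refl
    ... | no x≢v = cong (λ t → leaf x * (1 ∸ t)) (leafDegree≡codegree x≢v)

  pairs+pairs+∑isSingle≡m : pairs + pairs + sum isSingle ≡ m
  pairs+pairs+∑isSingle≡m = begin
    pairs + pairs + sum isSingle               ≡⟨ cong (λ t → pairs + t + sum isSingle) ∑isSecond≡pairs ⟨
    pairs + sum isSecond + sum isSingle        ≡⟨ cong (_+ sum isSingle) (∑-distrib-+ isFirst isSecond) ⟨
    ∑[ x < suc m ] (isFirst x + isSecond x) + sum isSingle ≡⟨ ∑-distrib-+ (λ x → isFirst x + isSecond x) isSingle ⟨
    ∑[ x < suc m ] (isFirst x + isSecond x + isSingle x)   ≡⟨ sum-cong-≗ leaf≡first+second+single ⟨
    sum leaf                                   ≡⟨ ∑leaf≡m ⟩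
    m                                          ∎
    where open ≡-Reasoning

  pairs+pairs≤m : pairs + pairs ≤ m
  pairs+pairs≤m = ≤-trans (m≤m+n (pairs + pairs) (sum isSingle)) (≤-reflexive pairs+pairs+∑isSingle≡m)

  2+rank+rank≤m : ∀ {x} → isFirst x ≡ 1 → suc (suc (rank x + rank x)) ≤ m
  2+rank+rank≤m {x} first-x = ≤-trans (≤-reflexive (sym (+-suc (suc (rank x)) (rank x))))
    (≤-trans (+-mono-≤ (rank<pairs first-x) (rank<pairs first-x)) pairs+pairs≤m)

  label≤m : ∀ x → label x ≤ m
  label≤m x with role x
  ... | centre refl = ≤-trans (≤-reflexive label-centre) z≤n
  ... | single x≢v alone = begin
    label x                       ≡⟨ label-single x≢v alone ⟩
    suc (pairs + pairs)           ≡⟨ +-comm 1 (pairs + pairs) ⟩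
    pairs + pairs + 1             ≡⟨ cong (pairs + pairs +_) (isSingle-single x≢v alone) ⟨
    pairs + pairs + isSingle x    ≤⟨ +-monoʳ-≤ (pairs + pairs) (term≤∑ isSingle x) ⟩
    pairs + pairs + sum isSingle  ≡⟨ pairs+pairs+∑isSingle≡m ⟩
    m                             ∎
    where open ≤-Reasoning
  ... | first w _ partner x<w = ≤-trans (≤-reflexive (label-first partner x<w))
    (≤-trans (n≤1+n _) (2+rank+rank≤m (isFirst-first partner x<w)))
  ... | second w _ partner w<x = ≤-trans (≤-reflexive (label-second partner w<x)) (2+rank+rank≤m (isFirst-second partner w<x))

  label-leaf : ∀ {x} → x ≢ v → ∃[ a ] label x ≡ suc a
  label-leaf {x} x≢v with role x
  ... | centre x≡v = ⊥-elim (x≢v x≡v)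
  ... | single _ alone = _ , label-single x≢v alone
  ... | first w _ partner x<w = _ , label-first partner x<w
  ... | second w _ partner w<x = _ , label-second partner w<x

  single-unique : ∀ {x y} → x ≢ v → y ≢ v → (∀ w → edge x w ≡ 0) → (∀ w → edge y w ≡ 0) → x ≡ y
  single-unique {x} {y} x≢v y≢v x-alone y-alone with x Fin.≟ y
  ... | yes x≡y = x≡y
  ... | no x≢y = ⊥-elim (1+n≰n (≤-trans (≤-reflexive (sym (cong₂ _+_ (isSingle-single x≢v x-alone) (isSingle-single y≢v y-alone))))
    (≤-trans (two-terms≤∑ isSingle x y x≢y) ∑isSingle≤1)))

  pairs≢rank : ∀ {x} → isFirst x ≡ 1 → pairs ≢ rank x
  pairs≢rank first-x pairs≡rank = <-irrefl (sym pairs≡rank) (rank<pairs first-x)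

  centre≢leaf : ∀ {y} → y ≢ v → label v ≢ label y
  centre≢leaf y≢v eq with label-leaf y≢v
  ... | _ , label≡suc = 0≢1+n (trans (sym label-centre) (trans eq label≡suc))

  odd-injective : ∀ {a b} → suc (a + a) ≡ suc (b + b) → a ≡ b
  odd-injective = double-injective ∘ suc-injective

  single≢first : ∀ {x y w} → x ≢ v → (∀ w → edge x w ≡ 0) → Partner y w → toℕ y < toℕ w → label x ≢ label y
  single≢first x≢v alone partner y<w eq = pairs≢rank (isFirst-first partner y<w)
    (odd-injective (trans (sym (label-single x≢v alone)) (trans eq (label-first partner y<w))))

  odd≢second : ∀ {x} k {y w} → label x ≡ suc (k + k) → Partner y w → toℕ w < toℕ y → label x ≢ label y
  odd≢second k {w = w} label-odd partner w<y eq =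
    odd≢even k (rank w) (trans (sym label-odd) (trans eq (label-second partner w<y)))

  label-injective : ∀ x y → label x ≡ label y → x ≡ y
  label-injective x y eq with role x | role y
  ... | centre x≡v | centre y≡v = trans x≡v (sym y≡v)
  ... | centre refl | single y≢v _ = ⊥-elim (centre≢leaf y≢v eq)
  ... | centre refl | first _ y≢v _ _ = ⊥-elim (centre≢leaf y≢v eq)
  ... | centre refl | second _ y≢v _ _ = ⊥-elim (centre≢leaf y≢v eq)
  ... | single x≢v _ | centre refl = ⊥-elim (centre≢leaf x≢v (sym eq))
  ... | first _ x≢v _ _ | centre refl = ⊥-elim (centre≢leaf x≢v (sym eq))
  ... | second _ x≢v _ _ | centre refl = ⊥-elim (centre≢leaf x≢v (sym eq))
  ... | single x≢v x-alone | single y≢v y-alone = single-unique x≢v y≢v x-alone y-alone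
  ... | single x≢v alone | first _ _ partner y<w = ⊥-elim (single≢first x≢v alone partner y<w eq)
  ... | first _ _ partner x<w | single y≢v alone = ⊥-elim (single≢first y≢v alone partner x<w (sym eq))
  ... | single x≢v alone | second _ _ partner w<y = ⊥-elim (odd≢second pairs (label-single x≢v alone) partner w<y eq)
  ... | second _ _ partner w<x | single y≢v alone = ⊥-elim (odd≢second pairs (label-single y≢v alone) partner w<x (sym eq))
  ... | first _ _ partner x<w | second _ _ partner′ w′<y = ⊥-elim (odd≢second (rank x) (label-first partner x<w) partner′ w′<y eq)
  ... | second _ _ partner w<x | first _ _ partner′ y<w′ = ⊥-elim (odd≢second (rank y) (label-first partner′ y<w′) partner w<x (sym eq))
  ... | first _ _ partner x<w | first _ _ partner′ y<w′ = rank-injective (isFirst-first partner x<w) (isFirst-first partner′ y<w′)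
    (odd-injective (trans (sym (label-first partner x<w)) (trans eq (label-first partner′ y<w′))))
  ... | second w _ partner w<x | second w′ _ partner′ w′<y = same-partner partner (subst (Partner y) (sym w≡w′) partner′)
    where
    w≡w′ : w ≡ w′
    w≡w′ = rank-injective (isFirst-second partner w<x) (isFirst-second partner′ w′<y)
      (odd-injective (suc-injective (trans (sym (label-second partner w<x)) (trans eq (label-second partner′ w′<y)))))

  fadj-cong : ∀ {p q p′ q′} → p ≡ p′ → q ≡ q′ → fadj p′ q′ ≡ true → fadj p q ≡ true
  fadj-cong refl refl pq = pq

  fadj-pair : ∀ k → fadj (suc (k + k)) (suc (suc (k + k))) ≡ true
  fadj-pair k = ⇒fadj-leaves (k + k) (suc (k + k)) (trans (⌊2k/2⌋≡k k) (sym (⌊1+2k/2⌋≡k k))) (1+n≢n ∘ sym)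

  adjacent-leaf-is-partner : ∀ {i j w} → i ≢ v → j ≢ v → adj G i j ≡ true → Partner i w → j ≡ w
  adjacent-leaf-is-partner {i} {j} {w} i≢v j≢v ij partner =
    δ≡1⇒≡ w j (trans (sym (edge≡δ partner j)) (adj⇒edge≡1 i≢v j≢v ij))

  adj⇒fadj-label : ∀ {i j} → i ≢ v → j ≢ v → adj G i j ≡ true → fadj (label i) (label j) ≡ true
  adj⇒fadj-label {i} {j} i≢v j≢v ij with role i
  ... | centre i≡v = ⊥-elim (i≢v i≡v)
  ... | single _ alone = ⊥-elim (0≢1+n (trans (sym (alone j)) (adj⇒edge≡1 i≢v j≢v ij)))
  ... | first w _ partner i<w rewrite adjacent-leaf-is-partner i≢v j≢v ij partner =
    fadj-cong (label-first partner i<w) (label-second (proj₂ (partner-symmetric partner)) i<w) (fadj-pair (rank i))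
  ... | second w _ partner w<i rewrite adjacent-leaf-is-partner i≢v j≢v ij partner =
    fadj-cong (label-second partner w<i) (label-first (proj₂ (partner-symmetric partner)) w<i)
      (trans (fadj-sym (suc (suc (rank w + rank w))) (suc (rank w + rank w))) (fadj-pair (rank w)))

  partner⇒adj : ∀ {x w} → Partner x w → adj G x w ≡ true
  partner⇒adj {w = w} partner = edge≡1⇒adj (trans (edge≡δ partner w) (δ-refl w))

  index : Fin (suc m) → ℕ
  index x = ⌊ pred (label x) /2⌋

  index-single : ∀ {x} → x ≢ v → (∀ w → edge x w ≡ 0) → index x ≡ pairs
  index-single x≢v alone = trans (cong (λ l → ⌊ pred l /2⌋) (label-single x≢v alone)) (⌊2k/2⌋≡k pairs)

  index-first : ∀ {x w} → Partner x w → toℕ x < toℕ w → index x ≡ rank x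
  index-first {x} partner x<w = trans (cong (λ l → ⌊ pred l /2⌋) (label-first partner x<w)) (⌊2k/2⌋≡k (rank x))

  index-second : ∀ {x w} → Partner x w → toℕ w < toℕ x → index x ≡ rank w
  index-second {w = w} partner w<x = trans (cong (λ l → ⌊ pred l /2⌋) (label-second partner w<x)) (⌊1+2k/2⌋≡k (rank w))

  fadj-label⇒ : ∀ {i j} → i ≢ v → j ≢ v → fadj (label i) (label j) ≡ true → index i ≡ index j × i ≢ j
  fadj-label⇒ {i} {j} i≢v j≢v ij with label-leaf i≢v | label-leaf j≢v
  ... | a , label-i | b , label-j with fadj-leaves⇒ a b (fadj-cong (sym label-i) (sym label-j) ij)
  ... | same , a≢b = trans (cong (λ l → ⌊ pred l /2⌋) label-i) (trans same (cong (λ l → ⌊ pred l /2⌋) (sym label-j))) ,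
    λ i≡j → a≢b (suc-injective (trans (sym label-i) (trans (cong label i≡j) label-j)))

  fadj-label⇒adj : ∀ {i j} → i ≢ v → j ≢ v → fadj (label i) (label j) ≡ true → adj G i j ≡ true
  fadj-label⇒adj {i} {j} i≢v j≢v ij with fadj-label⇒ i≢v j≢v ij | role i | role j
  ... | _ | centre i≡v | _ = ⊥-elim (i≢v i≡v)
  ... | _ | _ | centre j≡v = ⊥-elim (j≢v j≡v)
  ... | _ , i≢j | single _ i-alone | single _ j-alone = ⊥-elim (i≢j (single-unique i≢v j≢v i-alone j-alone))
  ... | same , _ | single _ alone | first _ _ partner j<w = ⊥-elim (pairs≢rank (isFirst-first partner j<w)
    (trans (sym (index-single i≢v alone)) (trans same (index-first partner j<w))))
  ... | same , _ | first _ _ partner i<w | single _ alone = ⊥-elim (pairs≢rank (isFirst-first partner i<w)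
    (trans (sym (index-single j≢v alone)) (trans (sym same) (index-first partner i<w))))
  ... | same , _ | single _ alone | second _ _ partner w<j = ⊥-elim (pairs≢rank (isFirst-second partner w<j)
    (trans (sym (index-single i≢v alone)) (trans same (index-second partner w<j))))
  ... | same , _ | second _ _ partner w<i | single _ alone = ⊥-elim (pairs≢rank (isFirst-second partner w<i)
    (trans (sym (index-single j≢v alone)) (trans (sym same) (index-second partner w<i))))
  ... | same , i≢j | first _ _ partner i<w | first _ _ partner′ j<w′ = ⊥-elim (i≢j (rank-injective
    (isFirst-first partner i<w) (isFirst-first partner′ j<w′) (trans (sym (index-first partner i<w)) (trans same (index-first partner′ j<w′)))))
  ... | same , _ | first _ _ partner i<w | second w′ _ partner′ w′<j =
    partner⇒adj (subst (λ t → Partner t j) (sym i≡w′) (proj₂ (partner-symmetric partner′)))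
    where
    i≡w′ : i ≡ w′
    i≡w′ = rank-injective (isFirst-first partner i<w) (isFirst-second partner′ w′<j)
      (trans (sym (index-first partner i<w)) (trans same (index-second partner′ w′<j)))
  ... | same , _ | second w _ partner w<i | first _ _ partner′ j<w′ = partner⇒adj (subst (Partner i) w≡j partner)
    where
    w≡j : w ≡ j
    w≡j = rank-injective (isFirst-second partner w<i) (isFirst-first partner′ j<w′)
      (trans (sym (index-second partner w<i)) (trans same (index-first partner′ j<w′)))
  ... | same , i≢j | second w _ partner w<i | second w′ _ partner′ w′<j =
    ⊥-elim (i≢j (same-partner partner (subst (Partner j) (sym w≡w′) partner′)))
    where
    w≡w′ : w ≡ w′
    w≡w′ = rank-injective (isFirst-second partner w<i) (isFirst-second partner′ w′<j)
      (trans (sym (index-second partner w<i)) (trans same (index-second partner′ w′<j)))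

  adj≡fadj-label : ∀ i j → adj G i j ≡ fadj (label i) (label j)
  adj≡fadj-label i j with i Fin.≟ v | j Fin.≟ v
  ... | yes refl | yes refl = trans (irrefl G i) (cong (λ t → fadj t t) (sym label-centre))
  ... | yes refl | no j≢v = trans (1≤A⇒adj G (≤-reflexive (sym (universal j j≢v))))
    (sym (fadj-cong label-centre (proj₂ (label-leaf j≢v)) refl))
  ... | no i≢v | yes refl = trans (adj-sym G (1≤A⇒adj G (≤-reflexive (sym (universal i i≢v)))))
    (sym (fadj-cong (proj₂ (label-leaf i≢v)) label-centre refl))
  ... | no i≢v | no j≢v = bool-ext (adj⇒fadj-label i≢v j≢v) (fadj-label⇒adj i≢v j≢v)

  relabel : Fin (suc m) → Fin (suc m)
  relabel x = fromℕ< (s≤s (label≤m x))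

  toℕ-relabel : ∀ x → toℕ (relabel x) ≡ label x
  toℕ-relabel x = toℕ-fromℕ< (s≤s (label≤m x))

  relabel-injective : Injective _≡_ _≡_ relabel
  relabel-injective {x} {y} eq = label-injective x y (trans (sym (toℕ-relabel x)) (trans (cong toℕ eq) (toℕ-relabel y)))


  isomorphic : G ≅ Friendship (suc m)
  isomorphic = proj₁ σ-relabel , preserves
    where
    σ-relabel : Σ[ σ ∈ Permutation′ (suc m) ] ∀ i → σ ⟨$⟩ʳ i ≡ relabel i
    σ-relabel = injective⇒permutation relabel relabel-injective
    preserves : ∀ i j → adj G i j ≡ fadj (toℕ (proj₁ σ-relabel ⟨$⟩ʳ i)) (toℕ (proj₁ σ-relabel ⟨$⟩ʳ j))
    preserves i j = begin
      adj G i j                                 ≡⟨ adj≡fadj-label i j ⟩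
      fadj (label i) (label j)                  ≡⟨ cong₂ fadj (toℕ-relabel i) (toℕ-relabel j) ⟨
      fadj (toℕ (relabel i)) (toℕ (relabel j))  ≡⟨ cong₂ (λ a b → fadj (toℕ a) (toℕ b)) (proj₂ σ-relabel i) (proj₂ σ-relabel j) ⟨
      fadj (toℕ (proj₁ σ-relabel ⟨$⟩ʳ i)) (toℕ (proj₁ σ-relabel ⟨$⟩ʳ j)) ∎
      where open ≡-Reasoning

theorem1p3 : ∃ λ (N : ℕ) → ∀ (n : ℕ) → N ≤ n →
    EvenCycleFree (Friendship n) ×
    (∀ (G : Graph n) → EvenCycleFree G → e₂ G ≤ e₂ (Friendship n)) ×
    (∀ (G : Graph n) → EvenCycleFree G → e₂ G ≡ e₂ (Friendship n) → G ≅ Friendship n)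
theorem1p3 = 100 , λ { (suc m) (s≤s 99≤m) → friendship-evenCycleFree (suc m) , maximal m 99≤m , unique m 99≤m }
  where
  maximal : ∀ m → 99 ≤ m → ∀ G → EvenCycleFree G → e₂ G ≤ e₂ (Friendship (suc m))
  maximal m 99≤m G noEven = ≤-trans (proj₁ (ExtremalBound.bounded m 99≤m G noEven)) (extremal≤e₂-friendship m)
  unique : ∀ m → 99 ≤ m → ∀ G → EvenCycleFree G → e₂ G ≡ e₂ (Friendship (suc m)) → G ≅ Friendship (suc m)
  unique m 99≤m G noEven e₂≡ with ExtremalBound.bounded m 99≤m G noEven
  ... | e₂≤extremal , extremal⇒friendshipLike
    with extremal⇒friendshipLike (≤-antisym e₂≤extremal (≤-trans (extremal≤e₂-friendship m) (≤-reflexive (sym e₂≡))))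
  ... | v , universal , fewSingles = FriendshipIsomorphism.isomorphic m G noEven v universal fewSingles
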